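{- Let $G$ be a finite connected graph with at least one edge and let $\Delta$ be any decision tree for $G$. Then $$T_G(x,y)=\sum_{T\text{ spanning tree of }G}x^{|\mathcal I(T)|}y^{|\mathcal E(T)|},$$ where $\mathcal I(T)$ (resp. $\mathcal E(T)$) is the set of $\Delta$-active edges of $T$ that belong to $T$ (resp. do not belong to $T$). In other words, the $\Delta$-activity is Tutte-descriptive.
   Context: Graphs are finite, loops and multiple edges allowed; $G$ has $m=|E(G)|\ge1$ edges. All subgraphs are spanning and identified with their edge sets. An isthmus is an edge whose deletion increases the number of connected components; an edge is standard if it is neither a loop nor an isthmus. $H\setminus e$ and $H/e$ denote deletion and contraction. Tutte polynomial: $T_G(x,y)=\sum_{S\subseteq E(G)}(x-1)^{c(S)-c(G)}(y-1)^{\beta(S)}$, where $c(S)$ is the number of connected components of the spanning subgraph $S$ and $\beta(S)=c(S)+|S|-|V(G)|$. A decision tree for $G$ is a perfect binary tree whose leaves are all at depth $m-1$ (root at depth $0$), each node labelled by an edge of $G$, such that along every root-to-leaf path the labels form a permutation of $E(G)$. Given a decision tree $\Delta$ and a subgraph $S$, the $\Delta$-types are assigned by: set $H:=G$, $n:=$ root of $\Delta$; for $k=1,\dots,m$ let $e_k$ be the label of $n$ and do exactly one of: (i) if $e_k$ is standard in $H$ and $e_k\notin S$: type $\mathbf S_e$, $H:=H\setminus e_k$, $n:=$ left child of $n$; (ii) if $e_k$ is a loop of $H$: type $\mathbf L$, $H:=H\setminus e_k$, $n:=$ left child; (iii) if $e_k$ is standard in $H$ and $e_k\in S$: type $\mathbf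 S_i$, $H:=H/e_k$, $n:=$ right child; (iv) if $e_k$ is an isthmus of $H$: type $\mathbf I$, $H:=H/e_k$, $n:=$ right child. An edge is $\Delta$-active for $S$ if its type is $\mathbf L$ or $\mathbf I$. -}

module Defs where

open import Data.Bool using (Bool; true; false; _∧_; _∨_; not; if_then_else_)
open import Data.Nat as ℕ using (ℕ; zero; suc; _∸_; _<ᵇ_; _≤ᵇ_)
open import Data.Fin as Fin using (Fin; toℕ)
open import Data.Fin.Subset using (Subset; ∁; ∣_∣; inside; outside)
open import Data.Product using (_×_; _,_)
open import Data.Vec using (Vec; lookup; _[_]≔_)
open import Data.List using (List; []; _∷_; _++_; allFin; filterᵇ; length; foldr)
open import Data.Bool.ListAction using (any; all)
open import Data.List.Relation.Binary.Permutation.Propositional using (_↭_)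
open import Data.Integer as ℤ using (ℤ)
open import Relation.Nullary.Decidable using (⌊_⌋)

allSubsets : (m : ℕ) → List (Subset m)
allSubsets zero = Data.Vec.[] ∷ []
allSubsets (suc m) =
  Data.List.map (inside Data.Vec.∷_) (allSubsets m) ++ Data.List.map (outside Data.Vec.∷_) (allSubsets m)

sumℤ : List ℤ → ℤ
sumℤ = foldr ℤ._+_ (ℤ.+ 0)

data DTree (m : ℕ) : ℕ → Set where
  leaf : Fin m → DTree m zero
  node : ∀ {d} → Fin m → (left right : DTree m d) → DTree m (suc d)

-- Labels along the root-to-leaf path selected by directions (false = left, true = right).
pathLabels : ∀ {m d} → DTree m d → Vec Bool d → List (Fin m)
pathLabels (leaf e) Data.Vec.[] = e ∷ []
pathLabels (node e l r) (false Data.Vec.∷ p) = e ∷ pathLabels l p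
pathLabels (node e l r) (true Data.Vec.∷ p) = e ∷ pathLabels r p

-- A decision tree for a graph with m = suc k edges: depth k, and along every
-- root-to-leaf path the labels form a permutation of E(G).
IsDecisionTree : ∀ {k} → DTree (suc k) k → Set
IsDecisionTree {k} Δ = ∀ (p : Vec Bool k) → pathLabels Δ p ↭ allFin (suc k)

-- A graph with vertex set Fin n and edge set Fin m; edge e has endpoints ends e
-- (loops: equal endpoints; multiple edges allowed).
module _ {n m : ℕ} (ends : Fin m → Fin n × Fin n) where

  reachWithin : ℕ → Subset m → Fin n → Fin n → Bool
  reachWithin zero S u v = ⌊ u Fin.≟ v ⌋
  reachWithin (suc k) S u v =
    reachWithin k S u v ∨
    any (λ e → lookup S e ∧ step (ends e)) (allFin m)
    where
      step : Fin n × Fin n → Bool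
      step (a , b) = (reachWithin k S u a ∧ ⌊ b Fin.≟ v ⌋) ∨ (reachWithin k S u b ∧ ⌊ a Fin.≟ v ⌋)

  -- u and v lie in the same connected component of the spanning subgraph S
  -- (walks with at most n edges suffice).
  connected : Subset m → Fin n → Fin n → Bool
  connected S = reachWithin n S

  -- c(S): number of connected components = number of vertices that are the
  -- least vertex of their component.
  c : Subset m → ℕ
  c S = length (filterᵇ isLeast (allFin n))
    where
      isLeast : Fin n → Bool
      isLeast v = all (λ u → not (connected S u v) ∨ (toℕ v ≤ᵇ toℕ u)) (allFin n)

  β : Subset m → ℕ
  β S = (c S ℕ.+ ∣ S ∣) ∸ n

  tutte : ℤ → ℤ → ℤ
  tutte x y = sumℤ (Data.List.map term (allSubsets m))
    where
      term : Subset m → ℤ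
      term S = ((x ℤ.- ℤ.+ 1) ℤ.^ (c S ∸ c Data.Fin.Subset.⊤)) ℤ.* ((y ℤ.- ℤ.+ 1) ℤ.^ β S)

  -- Spanning tree: connected (one component) and acyclic (β = 0) spanning subgraph.
  isSpanningTree : Subset m → Bool
  isSpanningTree T = (c T ℕ.≡ᵇ 1) ∧ (β T ℕ.≡ᵇ 0)

  -- The current minor H = (G \ D) / C, where D are the deleted and C the
  -- contracted edges so far.  Vertices of H are the classes of vertices of G
  -- connected through C.
  -- e is a loop of H iff its endpoints are identified by the contractions.
  isLoopIn : (D C : Subset m) → Fin m → Bool
  isLoopIn D C e with ends e
  ... | (a , b) = connected C a b

  -- e is an isthmus of H iff deleting it increases the number of components of H;
  -- components of H = components of G restricted to the non-deleted edges.
  isIsthmusIn : (D C : Subset m) → Fin m → Bool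
  isIsthmusIn D C e = c (∁ D) <ᵇ c (∁ D [ e ]≔ outside)

  -- Δ-active edges for S (types L and I), computed along the Δ-path of S.
  activeRun : ∀ {d} → DTree m d → Subset m → (D C : Subset m) → List (Fin m)
  activeRun (leaf e) S D C =
    if isLoopIn D C e ∨ isIsthmusIn D C e then e ∷ [] else []
  activeRun (node e l r) S D C =
    if isLoopIn D C e
      then e ∷ activeRun l S (D [ e ]≔ inside) C
      else (if isIsthmusIn D C e
        then e ∷ activeRun r S D (C [ e ]≔ inside)
        else (if lookup S e
          then activeRun r S D (C [ e ]≔ inside)
          else activeRun l S (D [ e ]≔ inside) C))

  active : ∀ {d} → DTree m d → Subset m → List (Fin m)
  active Δ S = activeRun Δ S Data.Fin.Subset.⊥ Data.Fin.Subset.⊥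

  internalActivity : ∀ {d} → DTree m d → Subset m → ℕ
  internalActivity Δ T = length (filterᵇ (lookup T) (active Δ T))

  externalActivity : ∀ {d} → DTree m d → Subset m → ℕ
  externalActivity Δ T = length (filterᵇ (λ e → not (lookup T e)) (active Δ T))

  activitySum : ∀ {d} → DTree m d → ℤ → ℤ → ℤ
  activitySum Δ x y = sumℤ (Data.List.map term (allSubsets m))
    where
      term : Subset m → ℤ
      term T = if isSpanningTree T
        then (x ℤ.^ internalActivity Δ T) ℤ.* (y ℤ.^ externalActivity Δ T)
        else ℤ.+ 0

module Submission where

open import Defs
open import Data.Bool using (Bool; true; false; _∧_; _∨_; not; if_then_else_; T)
open import Data.Bool.Properties using (∧-identityʳ)
open import Data.Nat as ℕ using (ℕ; zero; suc; _∸_; _≤_; _<_; z≤n; s≤s)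
import Data.Nat.Properties as ℕP
open import Data.Fin as Fin using (Fin; toℕ)
import Data.Fin.Properties as FinP
open import Data.Fin.Subset using (Subset; ⊤; ∁; ∣_∣) renaming (⊥ to ∅)
open import Data.Fin.Subset.Properties using (∣⊥∣≡0)
open import Data.Product using (Σ; _×_; _,_; proj₁; proj₂)
open import Data.Sum using (_⊎_; inj₁; inj₂)
open import Data.Empty using (⊥-elim)
open import Data.List using (List; []; _∷_; _++_; map; length; filterᵇ; tabulate; allFin)
open import Data.Bool.ListAction using (any; all; and)
open import Data.Vec using (Vec; lookup; _[_]≔_) renaming (_∷_ to _∷ᵥ_; [] to []ᵥ)
import Data.Vec.Properties as VecP
import Data.List.Properties as LP
open import Data.Vec.Relation.Binary.Pointwise.Extensional using (ext; Pointwise-≡⇒≡)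
open import Data.Integer as ℤ using (ℤ; _+_; _*_; _-_; _^_)
import Data.Integer.Properties as ℤP
open import Algebra.Properties.CommutativeSemigroup ℤP.+-commutativeSemigroup using (interchange)
open import Algebra.Properties.CommutativeSemigroup ℤP.*-commutativeSemigroup using (x∙yz≈y∙xz)
open import Data.Integer.Tactic.RingSolver using (solve-∀)
open import Function using (_∘_)
open import Relation.Nullary using (¬_)
open import Relation.Nullary.Decidable using (⌊_⌋; yes; no)
open import Relation.Binary.Definitions using (tri<; tri≈; tri>)
open import Relation.Binary.PropositionalEquality
open import Relation.Binary.PropositionalEquality.Properties using (setoid)
open import Data.List.Membership.Propositional using (_∈_)
open import Data.List.Membership.Propositional.Properties using (∈-allFin)
open import Data.List.Relation.Unary.Any using (here; there)
import Data.List.Relation.Unary.All as All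
open import Data.List.Relation.Unary.AllPairs using (_∷_)
open import Data.List.Relation.Unary.Unique.Propositional using (Unique)
open import Data.List.Relation.Unary.Unique.Propositional.Properties using (allFin⁺)
open import Data.List.Relation.Binary.Permutation.Propositional using (_↭_; ↭-sym; ↭⇒↭ₛ)
open import Data.List.Relation.Binary.Permutation.Propositional.Properties using (∈-resp-↭)
import Data.List.Relation.Binary.Permutation.Setoid.Properties as PermutationSetoid

-- Deletion–contraction is run along the decision tree Δ.  A node
-- of Δ is reached with a record of deleted edges D and contracted edges C; the
-- current minor is (G \ D) / C.  For such a record we consider two sums over
-- the interval C ⊆ S ⊆ ∁ D of subsets:
--   tutteMinor D C      = Σ_S (x-1)^(c(S) - c(∁D)) (y-1)^β(S), the Tutte polynomial
--                         of the minor while C is a spanning forest of G \ D;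
--   activityMinor f D C = Σ over spanning trees T in the interval of x^|f T ∩ T| y^|f T \ T|,
--                         where f T lists the labels Δ still produces for T.
-- Both satisfy the same recurrences: a factor y when the label e is a loop of
-- the minor (then e is deleted), a factor x when it is an isthmus (then e is
-- contracted), and a sum of the deletion and contraction when it is standard;
-- at a leaf, when every edge is decided and C = ∁ D is a spanning tree, both are 1.
-- The file develops, in order: Boolean and counting helpers, subset updates,
-- connectivity (walks, and how the component count c reacts to adding an edge),
-- sums over all subsets, the interval predicate `within`, loops and isthmuses of
-- the minor, the two recurrences, and finally the induction along Δ (expansion),
-- from which the theorem is the instance D = C = ∅.

∨-split : ∀ {a b} → (a ∨ b) ≡ true → a ≡ true ⊎ b ≡ true
∨-split {true} _ = inj₁ refl
∨-split {false} p = inj₂ p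

∨-inl : ∀ {a} b → a ≡ true → (a ∨ b) ≡ true
∨-inl b refl = refl

∨-inr : ∀ a {b} → b ≡ true → (a ∨ b) ≡ true
∨-inr true _ = refl
∨-inr false p = p

∧-split : ∀ {a b} → (a ∧ b) ≡ true → a ≡ true × b ≡ true
∧-split {true} {true} _ = refl , refl

∧-intro : ∀ {a b} → a ≡ true → b ≡ true → (a ∧ b) ≡ true
∧-intro refl refl = refl

true≢false : ∀ {b} → b ≡ true → b ≡ false → ∀ {A : Set} → A
true≢false refl ()

T⇒≡true : ∀ {b} → T b → b ≡ true
T⇒≡true {true} _ = refl

≡true⇒T : ∀ {b} → b ≡ true → T b
≡true⇒T refl = _

bool-ext : ∀ {a b} → (a ≡ true → b ≡ true) → (b ≡ true → a ≡ true) → a ≡ b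
bool-ext {true} {true} _ _ = refl
bool-ext {false} {false} _ _ = refl
bool-ext {true} {false} f _ = sym (f refl)
bool-ext {false} {true} _ g = g refl

bool-cases : ∀ {A : Set} b → (b ≡ true → A) → (b ≡ false → A) → A
bool-cases true f _ = f refl
bool-cases false _ g = g refl

count : ∀ {k} → (Fin k → Bool) → ℕ
count {zero} P = 0
count {suc k} P = if P Fin.zero then suc (count (P ∘ Fin.suc)) else count (P ∘ Fin.suc)

-- c is defined by filtering allFin = tabulate id; this turns it into a count.
length-filter-tabulate : ∀ {k} {A : Set} (P : A → Bool) (f : Fin k → A) →
  length (filterᵇ P (tabulate f)) ≡ count (P ∘ f)
length-filter-tabulate {zero} P f = refl
length-filter-tabulate {suc k} P f with P (f Fin.zero)
... | true = cong suc (length-filter-tabulate P (f ∘ Fin.suc))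
... | false = length-filter-tabulate P (f ∘ Fin.suc)

any-tabulate⇒ : ∀ {k} {A : Set} (p : A → Bool) (f : Fin k → A) →
  any p (tabulate f) ≡ true → Σ (Fin k) λ i → p (f i) ≡ true
any-tabulate⇒ {suc k} p f h with p (f Fin.zero) in eq
... | true = Fin.zero , eq
... | false with any-tabulate⇒ p (f ∘ Fin.suc) h
... | i , q = Fin.suc i , q

any-tabulate⇐ : ∀ {k} {A : Set} (p : A → Bool) (f : Fin k → A) i →
  p (f i) ≡ true → any p (tabulate f) ≡ true
any-tabulate⇐ p f Fin.zero q = ∨-inl _ q
any-tabulate⇐ p f (Fin.suc i) q = ∨-inr (p (f Fin.zero)) (any-tabulate⇐ p (f ∘ Fin.suc) i q)

all-tabulate⇒ : ∀ {k} {A : Set} (p : A → Bool) (f : Fin k → A) →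
  all p (tabulate f) ≡ true → ∀ i → p (f i) ≡ true
all-tabulate⇒ p f h Fin.zero = proj₁ (∧-split h)
all-tabulate⇒ p f h (Fin.suc i) = all-tabulate⇒ p (f ∘ Fin.suc) (proj₂ (∧-split h)) i

all-tabulate⇐ : ∀ {k} {A : Set} (p : A → Bool) (f : Fin k → A) →
  (∀ i → p (f i) ≡ true) → all p (tabulate f) ≡ true
all-tabulate⇐ {zero} p f h = refl
all-tabulate⇐ {suc k} p f h = ∧-intro (h Fin.zero) (all-tabulate⇐ p (f ∘ Fin.suc) (h ∘ Fin.suc))

any-cong : ∀ {A : Set} (p q : A → Bool) (xs : List A) → (∀ x → p x ≡ q x) → any p xs ≡ any q xs
any-cong p q [] h = refl
any-cong p q (x ∷ xs) h = cong₂ _∨_ (h x) (any-cong p q xs h)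

search : ∀ {k} (P : Fin k → Bool) → (∀ i → P i ≡ false) ⊎ Σ (Fin k) λ i → P i ≡ true
search {zero} P = inj₁ λ ()
search {suc k} P with P Fin.zero in eq
... | true = inj₂ (Fin.zero , eq)
... | false with search (P ∘ Fin.suc)
... | inj₂ (i , q) = inj₂ (Fin.suc i , q)
... | inj₁ h = inj₁ λ { Fin.zero → eq ; (Fin.suc i) → h i }

least : ∀ {k} (P : Fin k → Bool) i → P i ≡ true →
  Σ (Fin k) λ l → P l ≡ true × (∀ j → P j ≡ true → toℕ l ≤ toℕ j)
least {suc k} P i q with P Fin.zero in eq
... | true = Fin.zero , eq , λ _ _ → z≤n
least {suc k} P Fin.zero q | false = true≢false q eq
least {suc k} P (Fin.suc i) q | false with least (P ∘ Fin.suc) i q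
... | l , pl , h = Fin.suc l , pl , λ { Fin.zero r → true≢false r eq ; (Fin.suc j) r → s≤s (h j r) }

count-cong : ∀ {k} (P Q : Fin k → Bool) → (∀ i → P i ≡ Q i) → count P ≡ count Q
count-cong {zero} P Q h = refl
count-cong {suc k} P Q h rewrite h Fin.zero | count-cong (P ∘ Fin.suc) (Q ∘ Fin.suc) (h ∘ Fin.suc) = refl

count-mono : ∀ {k} (P Q : Fin k → Bool) → (∀ i → P i ≡ true → Q i ≡ true) → count P ≤ count Q
count-mono {zero} P Q h = z≤n
count-mono {suc k} P Q h with P Fin.zero in e₁ | Q Fin.zero in e₂
... | true | true = s≤s (count-mono (P ∘ Fin.suc) (Q ∘ Fin.suc) (h ∘ Fin.suc))
... | true | false = true≢false (h Fin.zero e₁) e₂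
... | false | true = ℕP.m≤n⇒m≤1+n (count-mono (P ∘ Fin.suc) (Q ∘ Fin.suc) (h ∘ Fin.suc))
... | false | false = count-mono (P ∘ Fin.suc) (Q ∘ Fin.suc) (h ∘ Fin.suc)

count-strict : ∀ {k} (P Q : Fin k → Bool) → (∀ i → P i ≡ true → Q i ≡ true) →
  ∀ w → P w ≡ false → Q w ≡ true → count P < count Q
count-strict {suc k} P Q h Fin.zero pw qw rewrite pw | qw = s≤s (count-mono (P ∘ Fin.suc) (Q ∘ Fin.suc) (h ∘ Fin.suc))
count-strict {suc k} P Q h (Fin.suc w) pw qw with P Fin.zero in e₁ | Q Fin.zero in e₂
... | true | true = s≤s (count-strict (P ∘ Fin.suc) (Q ∘ Fin.suc) (h ∘ Fin.suc) w pw qw)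
... | true | false = true≢false (h Fin.zero e₁) e₂
... | false | true = ℕP.m≤n⇒m≤1+n (count-strict (P ∘ Fin.suc) (Q ∘ Fin.suc) (h ∘ Fin.suc) w pw qw)
... | false | false = count-strict (P ∘ Fin.suc) (Q ∘ Fin.suc) (h ∘ Fin.suc) w pw qw

count-drop-one : ∀ {k} (P Q : Fin k → Bool) w → (∀ i → i ≢ w → P i ≡ Q i) →
  P w ≡ true → Q w ≡ false → count P ≡ suc (count Q)
count-drop-one {suc k} P Q Fin.zero h pw qw rewrite pw | qw =
  cong suc (count-cong (P ∘ Fin.suc) (Q ∘ Fin.suc) (λ i → h (Fin.suc i) λ ()))
count-drop-one {suc k} P Q (Fin.suc w) h pw qw
  rewrite h Fin.zero (λ ())
        | count-drop-one (P ∘ Fin.suc) (Q ∘ Fin.suc) w (λ i ne → h (Fin.suc i) (ne ∘ FinP.suc-injective)) pw qw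
  with Q Fin.zero
... | true = refl
... | false = refl

count-≤ : ∀ {k} (P : Fin k → Bool) → count P ≤ k
count-≤ P = ℕP.≤-trans (count-mono P (λ _ → true) (λ _ _ → refl)) (ℕP.≤-reflexive (count-true _))
  where
    count-true : ∀ k → count {k} (λ _ → true) ≡ k
    count-true zero = refl
    count-true (suc k) = cong suc (count-true k)

count-all : ∀ {k} (P : Fin k → Bool) → (∀ i → P i ≡ true) → count P ≡ k
count-all {zero} P h = refl
count-all {suc k} P h rewrite h Fin.zero = cong suc (count-all (P ∘ Fin.suc) (h ∘ Fin.suc))

count-pos : ∀ {k} (P : Fin k → Bool) w → P w ≡ true → 1 ≤ count P
count-pos P w q = ℕP.≤-trans (s≤s z≤n) (count-strict (λ _ → false) P (λ _ ()) w refl q)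

insert : ∀ {k} → Subset k → Fin k → Subset k
insert S e = S [ e ]≔ true

infix 4 _⊆_
_⊆_ : ∀ {k} → Subset k → Subset k → Set
S ⊆ S' = ∀ i → lookup S i ≡ true → lookup S' i ≡ true

subset-ext : ∀ {k} (V W : Subset k) → (∀ i → lookup V i ≡ lookup W i) → V ≡ W
subset-ext V W h = Pointwise-≡⇒≡ (ext h)

lookup-update : ∀ {k} (S : Subset k) e b → lookup (S [ e ]≔ b) e ≡ b
lookup-update S e b = VecP.lookup∘update e S b

lookup-update′ : ∀ {k} (S : Subset k) e i b → i ≢ e → lookup (S [ e ]≔ b) i ≡ lookup S i
lookup-update′ S e i b ne = VecP.lookup∘update′ ne S b

lookup-∁ : ∀ {k} (S : Subset k) i → lookup (∁ S) i ≡ not (lookup S i)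
lookup-∁ S i = VecP.lookup-map i not S

lookup-∅ : ∀ {k} (i : Fin k) → lookup (∅ {k}) i ≡ false
lookup-∅ Fin.zero = refl
lookup-∅ (Fin.suc i) = lookup-∅ i

∁-∅ : ∀ {k} → ∁ (∅ {k}) ≡ ⊤
∁-∅ {zero} = refl
∁-∅ {suc k} = cong (true ∷ᵥ_) (∁-∅ {k})

∣S∣≡0⇒∅ : ∀ {k} (S : Subset k) → ∣ S ∣ ≡ 0 → S ≡ ∅
∣S∣≡0⇒∅ []ᵥ _ = refl
∣S∣≡0⇒∅ (false ∷ᵥ S) h = cong (false ∷ᵥ_) (∣S∣≡0⇒∅ S h)

⊆-insert : ∀ {k} (S : Subset k) e → S ⊆ insert S e
⊆-insert S e i h with i Fin.≟ e
... | yes refl = lookup-update S e true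
... | no ne = trans (lookup-update′ S e i true ne) h

∣insert∣ : ∀ {k} (S : Subset k) e → lookup S e ≡ false → ∣ insert S e ∣ ≡ suc ∣ S ∣
∣insert∣ (false ∷ᵥ S) Fin.zero refl = refl
∣insert∣ (true ∷ᵥ S) (Fin.suc e) h = cong suc (∣insert∣ S e h)
∣insert∣ (false ∷ᵥ S) (Fin.suc e) h = ∣insert∣ S e h

nonempty : ∀ {k} (S : Subset k) {j} → ∣ S ∣ ≡ suc j → Σ (Fin k) λ e → lookup S e ≡ true
nonempty (true ∷ᵥ S) h = Fin.zero , refl
nonempty (false ∷ᵥ S) h with nonempty S h
... | e , q = Fin.suc e , q

insert-remove : ∀ {k} (S : Subset k) e → lookup S e ≡ true → insert (S [ e ]≔ false) e ≡ S
insert-remove S e h = subset-ext _ _ pointwise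
  where
    pointwise : ∀ i → lookup (insert (S [ e ]≔ false) e) i ≡ lookup S i
    pointwise i with i Fin.≟ e
    ... | yes refl = trans (lookup-update (S [ e ]≔ false) e true) (sym h)
    ... | no ne = trans (lookup-update′ (S [ e ]≔ false) e i true ne) (lookup-update′ S e i false ne)

-- Connectivity of spanning subgraphs.

module Connectivity {n m : ℕ} (ends : Fin m → Fin n × Fin n) where

  Sub : Set
  Sub = Subset m

  src tgt : Fin m → Fin n
  src e = proj₁ (ends e)
  tgt e = proj₂ (ends e)

  ≟-sound : ∀ {a b : Fin n} → ⌊ a Fin.≟ b ⌋ ≡ true → a ≡ b
  ≟-sound {a} {b} h with a Fin.≟ b
  ... | yes p = p

  ≟-refl : ∀ (a : Fin n) → ⌊ a Fin.≟ a ⌋ ≡ true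
  ≟-refl a with a Fin.≟ a
  ... | yes _ = refl
  ... | no ne = ⊥-elim (ne refl)

  Joins : Fin m → Fin n → Fin n → Set
  Joins e w v = (src e ≡ w × tgt e ≡ v) ⊎ (tgt e ≡ w × src e ≡ v)

  joins-sym : ∀ {e w v} → Joins e w v → Joins e v w
  joins-sym (inj₁ (p , q)) = inj₂ (q , p)
  joins-sym (inj₂ (p , q)) = inj₁ (q , p)

  data Path (S : Sub) (u : Fin n) : Fin n → Set where
    here : Path S u u
    step : ∀ {w v} → Path S u w → (e : Fin m) → lookup S e ≡ true → Joins e w v → Path S u v

  path-edge : ∀ {S w v} e → lookup S e ≡ true → Joins e w v → Path S w v
  path-edge e Se j = step here e Se j

  path-trans : ∀ {S u w v} → Path S u w → Path S w v → Path S u v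
  path-trans p here = p
  path-trans p (step q e Se j) = step (path-trans p q) e Se j

  path-sym : ∀ {S u v} → Path S u v → Path S v u
  path-sym here = here
  path-sym (step p e Se j) = path-trans (path-edge e Se (joins-sym j)) (path-sym p)

  path-mono : ∀ {S S' u v} → S ⊆ S' → Path S u v → Path S' u v
  path-mono h here = here
  path-mono h (step p e Se j) = step (path-mono h p) e (h e Se) j

  -- One round of the reachability iteration of Defs, written as a function of
  -- the set f of vertices already reached (definitionally equal to it).
  extendsTo : Sub → (Fin n → Bool) → Fin n → Fin m → Bool
  extendsTo S f v e = lookup S e ∧ ((f (src e) ∧ ⌊ tgt e Fin.≟ v ⌋) ∨ (f (tgt e) ∧ ⌊ src e Fin.≟ v ⌋))

  next : Sub → (Fin n → Bool) → Fin n → Bool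
  next S f v = f v ∨ any (extendsTo S f v) (allFin m)

  next-cong : ∀ S f g v → (∀ x → f x ≡ g x) → next S f v ≡ next S g v
  next-cong S f g v h = cong₂ _∨_ (h v) (any-cong (extendsTo S f v) (extendsTo S g v) (allFin m) step-cong)
    where
      step-cong : ∀ e → extendsTo S f v e ≡ extendsTo S g v e
      step-cong e rewrite h (src e) | h (tgt e) = refl

  reach : ℕ → Sub → Fin n → Fin n → Bool
  reach = reachWithin ends

  reach⇒path : ∀ k S u v → reach k S u v ≡ true → Path S u v
  reach⇒path zero S u v h with ≟-sound h
  ... | refl = here
  reach⇒path (suc k) S u v h with ∨-split {reach k S u v} h
  ... | inj₁ q = reach⇒path k S u v q
  ... | inj₂ q with any-tabulate⇒ (extendsTo S (reach k S u) v) (λ x → x) q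
  ... | e , q₂ with ∧-split {lookup S e} q₂
  ... | Se , q₃ with ∨-split {reach k S u (src e) ∧ ⌊ tgt e Fin.≟ v ⌋} q₃
  ... | inj₁ q₄ = step (reach⇒path k S u _ (proj₁ (∧-split q₄))) e Se
                      (inj₁ (refl , ≟-sound (proj₂ (∧-split {reach k S u (src e)} q₄))))
  ... | inj₂ q₄ = step (reach⇒path k S u _ (proj₁ (∧-split q₄))) e Se
                      (inj₂ (refl , ≟-sound (proj₂ (∧-split {reach k S u (tgt e)} q₄))))

  path⇒reach : ∀ {S u v} → Path S u v → Σ ℕ λ k → reach k S u v ≡ true
  path⇒reach {S} {u} here = zero , ≟-refl u
  path⇒reach {S} {u} {v} (step {w} p e Se j) with path⇒reach p
  ... | k , q = suc k , ∨-inr (reach k S u v)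
                  (any-tabulate⇐ (extendsTo S (reach k S u) v) (λ x → x) e (∧-intro Se (last-edge j)))
    where
      last-edge : Joins e w v →
        ((reach k S u (src e) ∧ ⌊ tgt e Fin.≟ v ⌋) ∨ (reach k S u (tgt e) ∧ ⌊ src e Fin.≟ v ⌋)) ≡ true
      last-edge (inj₁ (refl , refl)) = ∨-inl _ (∧-intro q (≟-refl _))
      last-edge (inj₂ (refl , refl)) = ∨-inr (reach k S u (src e) ∧ ⌊ tgt e Fin.≟ v ⌋) (∧-intro q (≟-refl _))

  reach-mono : ∀ k j S u v → k ≤ j → reach k S u v ≡ true → reach j S u v ≡ true
  reach-mono k j S u v le h with ℕP.m≤n⇒∃[o]m+o≡n le
  ... | o , refl = go o
    where
      go : ∀ o → reach (k ℕ.+ o) S u v ≡ true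
      go zero rewrite ℕP.+-identityʳ k = h
      go (suc o) rewrite ℕP.+-suc k o = ∨-inl _ (go o)

  -- The reachable sets from u grow strictly until they stabilise; as there are
  -- only n vertices, they are stable from round n on.
  module Stabilisation (S : Sub) (u : Fin n) where
    R : ℕ → Fin n → Bool
    R k = reach k S u

    Stable : ℕ → Set
    Stable k = ∀ j v → R (j ℕ.+ k) v ≡ R k v

    stable-from : ∀ k → (∀ v → R (suc k) v ≡ R k v) → Stable k
    stable-from k h zero v = refl
    stable-from k h (suc j) v = trans (next-cong S (R (j ℕ.+ k)) (R k) v (stable-from k h j)) (h v)

    stable-suc : ∀ k → Stable k → Stable (suc k)
    stable-suc k st j v = trans (cong (λ t → R t v) (ℕP.+-suc j k)) (trans (st (suc j) v) (sym (st 1 v)))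

    grows-or-stable : ∀ k → suc k ≤ count (R k) ⊎ Stable k
    grows-or-stable zero = inj₁ (count-pos (R zero) u (≟-refl u))
    grows-or-stable (suc k) with grows-or-stable k
    ... | inj₂ st = inj₂ (stable-suc k st)
    ... | inj₁ big with search (λ v → R (suc k) v ∧ not (R k v))
    ... | inj₂ (v , q) = inj₁ (ℕP.≤-trans (s≤s big)
            (count-strict (R k) (R (suc k)) (λ v → ∨-inl _) v (not-true (proj₂ (∧-split q))) (proj₁ (∧-split q))))
      where
        not-true : ∀ {b} → not b ≡ true → b ≡ false
        not-true {false} _ = refl
    ... | inj₁ none = inj₂ (stable-suc k (stable-from k (λ v → same (R k v) (R (suc k) v) (∨-inl _) (none v))))
      where
        same : ∀ a b → (a ≡ true → b ≡ true) → b ∧ not a ≡ false → b ≡ a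
        same true true _ _ = refl
        same false false _ _ = refl
        same true false f _ = f refl
        same false true _ ()

    reach⇒reach-n : ∀ k v → R k v ≡ true → R n v ≡ true
    reach⇒reach-n k v h with grows-or-stable n
    ... | inj₁ big = ⊥-elim (ℕP.<-irrefl refl (ℕP.≤-trans big (count-≤ (R n))))
    ... | inj₂ st with ℕP.≤-total k n
    ... | inj₁ le = reach-mono k n S u v le h
    ... | inj₂ le = trans (sym (st (k ∸ n) v)) (trans (cong (λ t → R t v) (ℕP.m∸n+n≡m le)) h)

  conn : Sub → Fin n → Fin n → Bool
  conn = connected ends

  connected⇒path : ∀ {S u v} → conn S u v ≡ true → Path S u v
  connected⇒path {S} {u} {v} = reach⇒path n S u v

  path⇒connected : ∀ {S u v} → Path S u v → conn S u v ≡ true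
  path⇒connected {S} {u} {v} p with path⇒reach p
  ... | k , q = Stabilisation.reach⇒reach-n S u k v q

  conn-mono : ∀ {S S' u v} → S ⊆ S' → conn S u v ≡ true → conn S' u v ≡ true
  conn-mono h q = path⇒connected (path-mono h (connected⇒path q))

  -- A walk using S plus the edge e either avoids e or crosses it once.
  ViaEdge : Sub → Fin n → Fin n → Fin n → Fin n → Set
  ViaEdge S a b u v = Path S u v ⊎ (Path S u a × Path S b v) ⊎ (Path S u b × Path S a v)

  via-swap : ∀ {S a b u v} → ViaEdge S a b u v → ViaEdge S b a u v
  via-swap (inj₁ q) = inj₁ q
  via-swap (inj₂ (inj₁ q)) = inj₂ (inj₂ q)
  via-swap (inj₂ (inj₂ q)) = inj₂ (inj₁ q)

  path-insert : ∀ S e {u v} → Path (insert S e) u v → ViaEdge S (src e) (tgt e) u v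
  path-insert S e here = inj₁ here
  path-insert S e (step p f Sf j) with path-insert S e p | f Fin.≟ e
  ... | inj₁ q | no ne = inj₁ (step q f (trans (sym (lookup-update′ S e f true ne)) Sf) j)
  ... | inj₂ (inj₁ (q₁ , q₂)) | no ne = inj₂ (inj₁ (q₁ , step q₂ f (trans (sym (lookup-update′ S e f true ne)) Sf) j))
  ... | inj₂ (inj₂ (q₁ , q₂)) | no ne = inj₂ (inj₂ (q₁ , step q₂ f (trans (sym (lookup-update′ S e f true ne)) Sf) j))
  ... | inj₁ q | yes refl with j
  ...   | inj₁ (refl , refl) = inj₂ (inj₁ (q , here))
  ...   | inj₂ (refl , refl) = inj₂ (inj₂ (q , here))
  path-insert S e (step p f Sf j) | inj₂ (inj₁ (q₁ , q₂)) | yes refl with j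
  ...   | inj₁ (refl , refl) = inj₁ (path-trans q₁ (path-sym q₂))
  ...   | inj₂ (refl , refl) = inj₁ q₁
  path-insert S e (step p f Sf j) | inj₂ (inj₂ (q₁ , q₂)) | yes refl with j
  ...   | inj₁ (refl , refl) = inj₁ q₁
  ...   | inj₂ (refl , refl) = inj₁ (path-trans q₁ (path-sym q₂))

  isLeast : Sub → Fin n → Bool
  isLeast S v = all (λ u → not (conn S u v) ∨ (toℕ v ℕ.≤ᵇ toℕ u)) (allFin n)

  c-count : ∀ S → c ends S ≡ count (isLeast S)
  c-count S = length-filter-tabulate (isLeast S) (λ x → x)

  isLeast⇒ : ∀ {S u v} → isLeast S v ≡ true → Path S u v → toℕ v ≤ toℕ u
  isLeast⇒ {S} {u} {v} h p with all-tabulate⇒ (λ u → not (conn S u v) ∨ (toℕ v ℕ.≤ᵇ toℕ u)) (λ x → x) h u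
  ... | q rewrite path⇒connected p = ℕP.≤ᵇ⇒≤ (toℕ v) (toℕ u) (≡true⇒T q)

  isLeast⇐ : ∀ {S v} → (∀ u → Path S u v → toℕ v ≤ toℕ u) → isLeast S v ≡ true
  isLeast⇐ {S} {v} h = all-tabulate⇐ _ (λ x → x) below
    where
      below : ∀ u → (not (conn S u v) ∨ (toℕ v ℕ.≤ᵇ toℕ u)) ≡ true
      below u with conn S u v in eq
      ... | false = refl
      ... | true with toℕ v ℕ.≤ᵇ toℕ u in le
      ...   | true = refl
      ...   | false = true≢false (T⇒≡true (ℕP.≤⇒≤ᵇ (h u (connected⇒path eq)))) le

  c-cong : ∀ S S' → (∀ {u v} → Path S' u v → Path S u v) → (∀ {u v} → Path S u v → Path S' u v) →
    c ends S ≡ c ends S'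
  c-cong S S' f g = trans (c-count S) (trans (count-cong _ _ same) (sym (c-count S')))
    where
      same : ∀ v → isLeast S v ≡ isLeast S' v
      same v = bool-ext (λ h → isLeast⇐ λ u p → isLeast⇒ h (f p)) (λ h → isLeast⇐ λ u p → isLeast⇒ h (g p))

  c-insert-connected : ∀ S e → conn S (src e) (tgt e) ≡ true → c ends (insert S e) ≡ c ends S
  c-insert-connected S e h = c-cong (insert S e) S (path-mono (⊆-insert S e)) avoid
    where
      ab = connected⇒path h
      avoid : ∀ {u v} → Path (insert S e) u v → Path S u v
      avoid p with path-insert S e p
      ... | inj₁ q = q
      ... | inj₂ (inj₁ (q₁ , q₂)) = path-trans q₁ (path-trans ab q₂)
      ... | inj₂ (inj₂ (q₁ , q₂)) = path-trans q₁ (path-trans (path-sym ab) q₂)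

  Least : Sub → Fin n → Set
  Least S x = Σ (Fin n) λ l → Path S l x × (∀ j → Path S j x → toℕ l ≤ toℕ j)

  least-of : ∀ S x → Least S x
  least-of S x with least (λ j → conn S j x) x (path⇒connected here)
  ... | l , pl , h = l , connected⇒path pl , λ j p → h j (path⇒connected p)

  least-isLeast : ∀ S x → (L : Least S x) → isLeast S (proj₁ L) ≡ true
  least-isLeast S x (l , pl , h) = isLeast⇐ λ u p → h u (path-trans p pl)

  -- Merging the components of x and y (with least vertices lx < ly) into one
  -- loses exactly the representative ly.
  merge-components : ∀ S S' x y → (∀ {u v} → Path S u v → Path S' u v) →
    (∀ {u v} → Path S' u v → ViaEdge S x y u v) → Path S' x y →
    (Lx : Least S x) (Ly : Least S y) → toℕ (proj₁ Lx) < toℕ (proj₁ Ly) →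
    count (isLeast S) ≡ suc (count (isLeast S'))
  merge-components S S' x y mono via link (lx , plx , hx) (ly , ply , hy) lt =
    count-drop-one (isLeast S) (isLeast S') ly others (least-isLeast S y (ly , ply , hy)) ly-absorbed
    where
      ly-absorbed : isLeast S' ly ≡ false
      ly-absorbed with isLeast S' ly in eq
      ... | false = refl
      ... | true = ⊥-elim (ℕP.<-irrefl refl
                     (ℕP.<-≤-trans lt (isLeast⇒ eq (path-trans (mono plx) (path-trans link (mono (path-sym ply)))))))
      others : ∀ v → v ≢ ly → isLeast S v ≡ isLeast S' v
      others v ne = bool-ext forward (λ h → isLeast⇐ λ u p → isLeast⇒ h (mono p))
        where
          forward : isLeast S v ≡ true → isLeast S' v ≡ true
          forward h = isLeast⇐ λ u p → below u (via p)
            where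
              below : ∀ u → ViaEdge S x y u v → toℕ v ≤ toℕ u
              below u (inj₁ q) = isLeast⇒ h q
              below u (inj₂ (inj₁ (q₁ , q₂))) =
                ⊥-elim (ne (FinP.toℕ-injective (ℕP.≤-antisym (isLeast⇒ h (path-trans ply q₂)) (hy v (path-sym q₂)))))
              below u (inj₂ (inj₂ (q₁ , q₂))) =
                ℕP.≤-trans (isLeast⇒ h (path-trans plx q₂)) (ℕP.≤-trans (ℕP.<⇒≤ lt) (hy u q₁))

  c-insert-bridge : ∀ S e → conn S (src e) (tgt e) ≡ false → c ends S ≡ suc (c ends (insert S e))
  c-insert-bridge S e h = trans (c-count S) (trans merged (cong suc (sym (c-count (insert S e)))))
    where
      La = least-of S (src e)
      Lb = least-of S (tgt e)
      link : Path (insert S e) (src e) (tgt e)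
      link = path-edge e (lookup-update S e true) (inj₁ (refl , refl))
      distinct : proj₁ La ≢ proj₁ Lb
      distinct eq = true≢false (path⇒connected (path-trans (path-sym (proj₁ (proj₂ La)))
                      (subst (λ z → Path S z (tgt e)) (sym eq) (proj₁ (proj₂ Lb))))) h
      merged : count (isLeast S) ≡ suc (count (isLeast (insert S e)))
      merged with ℕP.<-cmp (toℕ (proj₁ La)) (toℕ (proj₁ Lb))
      ... | tri< lt _ _ = merge-components S (insert S e) _ _ (path-mono (⊆-insert S e)) (path-insert S e) link La Lb lt
      ... | tri≈ _ eq _ = ⊥-elim (distinct (FinP.toℕ-injective eq))
      ... | tri> _ _ gt = merge-components S (insert S e) _ _ (path-mono (⊆-insert S e))
                            (via-swap ∘ path-insert S e) (path-sym link) Lb La gt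

  c-mono : ∀ S S' → S ⊆ S' → c ends S' ≤ c ends S
  c-mono S S' h = subst₂ _≤_ (sym (c-count S')) (sym (c-count S))
    (count-mono (isLeast S') (isLeast S) (λ v q → isLeast⇐ λ u p → isLeast⇒ q (path-mono h p)))

  c-pos : ∀ S → Fin n → 1 ≤ c ends S
  c-pos S x = subst (1 ≤_) (sym (c-count S)) (count-pos (isLeast S) _ (least-isLeast S x (least-of S x)))

  c-∅ : c ends ∅ ≡ n
  c-∅ = trans (c-count ∅) (count-all (isLeast ∅) λ v → isLeast⇐ λ u p → ℕP.≤-reflexive (cong toℕ (sym (trivial p))))
    where
      trivial : ∀ {u v} → Path ∅ u v → u ≡ v
      trivial here = refl
      trivial (step p e Se _) = true≢false Se (lookup-∅ e)

  c-insert : ∀ S e → c ends S ≤ suc (c ends (insert S e))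
  c-insert S e with conn S (src e) (tgt e) in eq
  ... | true = ℕP.m≤n⇒m≤1+n (ℕP.≤-reflexive (sym (c-insert-connected S e eq)))
  ... | false = ℕP.≤-reflexive (c-insert-bridge S e eq)

  -- Rank inequality: every spanning subgraph S has n ≤ c(S) + |S|, so β(S)
  -- is a genuine (untruncated) difference.
  rank : ∀ S → n ≤ c ends S ℕ.+ ∣ S ∣
  rank S = go _ S refl
    where
      go : ∀ j S → ∣ S ∣ ≡ j → n ≤ c ends S ℕ.+ j
      go zero S h rewrite ∣S∣≡0⇒∅ S h = ℕP.≤-reflexive (trans (sym c-∅) (sym (ℕP.+-identityʳ _)))
      go (suc j) S h with nonempty S h
      ... | e , q = ℕP.≤-trans (go j S' ∣S'∣)
                      (ℕP.≤-trans (ℕP.+-monoˡ-≤ j (c-insert S' e))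
                        (ℕP.≤-reflexive (trans (cong (λ z → suc (c ends z) ℕ.+ j) (insert-remove S e q)) (sym (ℕP.+-suc _ j)))))
        where
          S' = S [ e ]≔ false
          ∣S'∣ : ∣ S' ∣ ≡ j
          ∣S'∣ = ℕP.suc-injective (trans (sym (∣insert∣ S' e (lookup-update S e false)))
                   (trans (cong ∣_∣ (insert-remove S e q)) h))

0ℤ : ℤ
0ℤ = ℤ.+ 0

-- The two ring identities behind the recurrences T = y·T(G\e) and T = x·T(G/e).
pred-*-+ : ∀ y A → (y - ℤ.+ 1) * A + A ≡ y * A
pred-*-+ = solve-∀

+-pred-* : ∀ x A → A + (x - ℤ.+ 1) * A ≡ x * A
+-pred-* = solve-∀

sum-++ : ∀ (xs ys : List ℤ) → sumℤ (xs ++ ys) ≡ sumℤ xs + sumℤ ys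
sum-++ [] ys = sym (ℤP.+-identityˡ _)
sum-++ (x ∷ xs) ys rewrite sum-++ xs ys = sym (ℤP.+-assoc x _ _)

module _ {A : Set} where

  sum-cong : ∀ (f g : A → ℤ) xs → (∀ x → f x ≡ g x) → sumℤ (map f xs) ≡ sumℤ (map g xs)
  sum-cong f g [] h = refl
  sum-cong f g (x ∷ xs) h = cong₂ _+_ (h x) (sum-cong f g xs h)

  sum-+ : ∀ (f g : A → ℤ) xs → sumℤ (map (λ x → f x + g x) xs) ≡ sumℤ (map f xs) + sumℤ (map g xs)
  sum-+ f g [] = refl
  sum-+ f g (x ∷ xs) rewrite sum-+ f g xs = interchange (f x) (g x) (sumℤ (map f xs)) (sumℤ (map g xs))

  sum-* : ∀ k (f : A → ℤ) xs → sumℤ (map (λ x → k * f x) xs) ≡ k * sumℤ (map f xs)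
  sum-* k f [] = sym (ℤP.*-zeroʳ k)
  sum-* k f (x ∷ xs) rewrite sum-* k f xs = sym (ℤP.*-distribˡ-+ k (f x) (sumℤ (map f xs)))

  sum-0 : ∀ (f : A → ℤ) xs → (∀ x → f x ≡ 0ℤ) → sumℤ (map f xs) ≡ 0ℤ
  sum-0 f [] h = refl
  sum-0 f (x ∷ xs) h rewrite h x | sum-0 f xs h = refl

-- ΣS f = Σ_{S ⊆ Fin m} f S.  It is kept abstract so that the equations below,
-- and not the underlying list, are the only way to compute with it.
abstract
  ΣS : ∀ {m} → (Subset m → ℤ) → ℤ
  ΣS {m} f = sumℤ (map f (allSubsets m))

  ΣS-def : ∀ {m} (f : Subset m → ℤ) → ΣS f ≡ sumℤ (map f (allSubsets m))
  ΣS-def f = refl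

  ΣS-cong : ∀ {m} (f g : Subset m → ℤ) → (∀ S → f S ≡ g S) → ΣS f ≡ ΣS g
  ΣS-cong {m} f g h = sum-cong f g (allSubsets m) h

  ΣS-0 : ∀ {m} (f : Subset m → ℤ) → (∀ S → f S ≡ 0ℤ) → ΣS f ≡ 0ℤ
  ΣS-0 {m} f h = sum-0 f (allSubsets m) h

  ΣS-+ : ∀ {m} (f g : Subset m → ℤ) → ΣS (λ S → f S + g S) ≡ ΣS f + ΣS g
  ΣS-+ {m} f g = sum-+ f g (allSubsets m)

  ΣS-* : ∀ {m} k (f : Subset m → ℤ) → ΣS (λ S → k * f S) ≡ k * ΣS f
  ΣS-* {m} k f = sum-* k f (allSubsets m)

  ΣS-suc : ∀ {m} (f : Subset (suc m) → ℤ) → ΣS f ≡ ΣS (λ S → f (true ∷ᵥ S)) + ΣS (λ S → f (false ∷ᵥ S))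
  ΣS-suc {m} f = begin
    sumℤ (map f (ins ++ outs))                   ≡⟨ cong sumℤ (LP.map-++ f ins outs) ⟩
    sumℤ (map f ins ++ map f outs)               ≡⟨ sum-++ (map f ins) (map f outs) ⟩
    sumℤ (map f ins) + sumℤ (map f outs)         ≡⟨ cong₂ _+_ (cong sumℤ (sym (LP.map-∘ (allSubsets m))))
                                                               (cong sumℤ (sym (LP.map-∘ (allSubsets m)))) ⟩
    ΣS (λ S → f (true ∷ᵥ S)) + ΣS (λ S → f (false ∷ᵥ S)) ∎
    where
      open ≡-Reasoning
      ins outs : List (Subset (suc m))
      ins = map (true ∷ᵥ_) (allSubsets m)
      outs = map (false ∷ᵥ_) (allSubsets m)

ΣS-split : ∀ {m} (e : Fin m) (g : Subset m → ℤ) →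
  ΣS g ≡ ΣS (λ S → if lookup S e then g S else 0ℤ) + ΣS (λ S → if lookup S e then 0ℤ else g S)
ΣS-split e g = trans (ΣS-cong _ _ split) (ΣS-+ _ _)
  where
    split : ∀ S → g S ≡ (if lookup S e then g S else 0ℤ) + (if lookup S e then 0ℤ else g S)
    split S with lookup S e
    ... | true = sym (ℤP.+-identityʳ _)
    ... | false = sym (ℤP.+-identityˡ _)

-- Reindexing by S ↦ S ∪ {e}: the subsets containing e are exactly the
-- insertions of e into the subsets avoiding e.
ΣS-shift : ∀ {m} (e : Fin m) (g : Subset m → ℤ) →
  ΣS (λ S → if lookup S e then g S else 0ℤ) ≡ ΣS (λ S → if lookup S e then 0ℤ else g (insert S e))
ΣS-shift {suc m} Fin.zero g = begin
  ΣS (λ S → if lookup S Fin.zero then g S else 0ℤ)    ≡⟨ ΣS-suc {m} _ ⟩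
  A + ΣS {m} (λ _ → 0ℤ)                                ≡⟨ cong (A +_) (ΣS-0 {m} _ (λ _ → refl)) ⟩
  A + 0ℤ                                               ≡⟨ ℤP.+-comm A 0ℤ ⟩
  0ℤ + A                                               ≡⟨ cong (_+ A) (sym (ΣS-0 {m} _ (λ _ → refl))) ⟩
  ΣS {m} (λ _ → 0ℤ) + A                                ≡⟨ sym (ΣS-suc {m} _) ⟩
  ΣS (λ S → if lookup S Fin.zero then 0ℤ else g (insert S Fin.zero)) ∎
  where
    open ≡-Reasoning
    A : ℤ
    A = ΣS (λ S → g (true ∷ᵥ S))
ΣS-shift {suc m} (Fin.suc e) g = begin
  ΣS (λ S → if lookup S (Fin.suc e) then g S else 0ℤ)
    ≡⟨ ΣS-suc {m} _ ⟩
  ΣS (λ S → if lookup S e then g (true ∷ᵥ S) else 0ℤ) + ΣS (λ S → if lookup S e then g (false ∷ᵥ S) else 0ℤ)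
    ≡⟨ cong₂ _+_ (ΣS-shift e (g ∘ (true ∷ᵥ_))) (ΣS-shift e (g ∘ (false ∷ᵥ_))) ⟩
  ΣS (λ S → if lookup S e then 0ℤ else g (true ∷ᵥ insert S e))
    + ΣS (λ S → if lookup S e then 0ℤ else g (false ∷ᵥ insert S e))
    ≡⟨ sym (ΣS-suc {m} _) ⟩
  ΣS (λ S → if lookup S (Fin.suc e) then 0ℤ else g (insert S (Fin.suc e))) ∎
  where open ≡-Reasoning

_==_ : ∀ {k} → Subset k → Subset k → Bool
[]ᵥ == []ᵥ = true
(a ∷ᵥ V) == (b ∷ᵥ W) = (if a then b else not b) ∧ (V == W)

==-sound : ∀ {k} (V W : Subset k) → (V == W) ≡ true → V ≡ W
==-sound []ᵥ []ᵥ h = refl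
==-sound (true ∷ᵥ V) (true ∷ᵥ W) h = cong (true ∷ᵥ_) (==-sound V W h)
==-sound (false ∷ᵥ V) (false ∷ᵥ W) h = cong (false ∷ᵥ_) (==-sound V W h)

==-refl : ∀ {k} (V : Subset k) → (V == V) ≡ true
==-refl []ᵥ = refl
==-refl (true ∷ᵥ V) = ==-refl V
==-refl (false ∷ᵥ V) = ==-refl V

ΣS-single : ∀ {m} (S₀ : Subset m) (g : Subset m → ℤ) → ΣS (λ S → if S == S₀ then g S else 0ℤ) ≡ g S₀
ΣS-single {zero} []ᵥ g = trans (ΣS-def _) (ℤP.+-identityʳ _)
ΣS-single {suc m} (true ∷ᵥ S₀) g = begin
  _                                                           ≡⟨ ΣS-suc {m} _ ⟩
  ΣS (λ S → if S == S₀ then g (true ∷ᵥ S) else 0ℤ) + ΣS {m} (λ _ → 0ℤ)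
                                                              ≡⟨ cong₂ _+_ (ΣS-single S₀ (g ∘ (true ∷ᵥ_))) (ΣS-0 {m} _ (λ _ → refl)) ⟩
  g (true ∷ᵥ S₀) + 0ℤ                                         ≡⟨ ℤP.+-identityʳ _ ⟩
  g (true ∷ᵥ S₀)                                              ∎
  where open ≡-Reasoning
ΣS-single {suc m} (false ∷ᵥ S₀) g = begin
  _                                                           ≡⟨ ΣS-suc {m} _ ⟩
  ΣS {m} (λ _ → 0ℤ) + ΣS (λ S → if S == S₀ then g (false ∷ᵥ S) else 0ℤ)
                                                              ≡⟨ cong₂ _+_ (ΣS-0 {m} _ (λ _ → refl)) (ΣS-single S₀ (g ∘ (false ∷ᵥ_))) ⟩
  0ℤ + g (false ∷ᵥ S₀)                                        ≡⟨ ℤP.+-identityˡ _ ⟩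
  g (false ∷ᵥ S₀)                                             ∎
  where open ≡-Reasoning

-- An edge that is contracted must lie in S, one that is deleted must not.
respects : Bool → Bool → Bool → Bool
respects d c s = (not c ∨ s) ∧ (not s ∨ not d)

-- within D C S holds iff C ⊆ S ⊆ ∁ D.
within : ∀ {k} → Subset k → Subset k → Subset k → Bool
within {k} D C S = all (λ i → respects (lookup D i) (lookup C i) (lookup S i)) (allFin k)

within⇒respects : ∀ {k} (D C S : Subset k) → within D C S ≡ true →
  ∀ i → respects (lookup D i) (lookup C i) (lookup S i) ≡ true
within⇒respects D C S = all-tabulate⇒ _ (λ i → i)

within-false : ∀ {k} (D C S : Subset k) e → respects (lookup D e) (lookup C e) (lookup S e) ≡ false →
  within D C S ≡ false
within-false D C S e h with within D C S in eq
... | false = refl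
... | true = true≢false (within⇒respects D C S eq e) h

within-∅ : ∀ {k} (S : Subset k) → within ∅ ∅ S ≡ true
within-∅ S = all-tabulate⇐ _ (λ i → i) respects-∅
  where
    respects-∅ : ∀ i → respects (lookup ∅ i) (lookup ∅ i) (lookup S i) ≡ true
    respects-∅ i rewrite lookup-∅ i with lookup S i
    ... | true = refl
    ... | false = refl

within⇒C⊆S : ∀ {k} (D C S : Subset k) → within D C S ≡ true → C ⊆ S
within⇒C⊆S D C S h i q = lemma (within⇒respects D C S h i) q
  where
    lemma : ∀ {d c s} → respects d c s ≡ true → c ≡ true → s ≡ true
    lemma {d} {true} {true} _ refl = refl
    lemma {true} {true} {false} () refl
    lemma {false} {true} {false} () refl

within⇒S⊆∁D : ∀ {k} (D C S : Subset k) → within D C S ≡ true → S ⊆ ∁ D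
within⇒S⊆∁D D C S h i q = trans (lookup-∁ D i) (cong not (lemma (within⇒respects D C S h i) q))
  where
    lemma : ∀ {d c s} → respects d c s ≡ true → s ≡ true → d ≡ false
    lemma {false} {c} {true} _ refl = refl
    lemma {true} {false} {true} () refl
    lemma {true} {true} {true} () refl

within-set : ∀ {k} (D C S : Subset k) e d c s →
  respects d c s ≡ respects (lookup D e) (lookup C e) (lookup S e) →
  within (D [ e ]≔ d) (C [ e ]≔ c) (S [ e ]≔ s) ≡ within D C S
within-set {k} D C S e d c s he = cong and (LP.map-cong pointwise (allFin k))
  where
    pointwise : ∀ i → respects (lookup (D [ e ]≔ d) i) (lookup (C [ e ]≔ c) i) (lookup (S [ e ]≔ s) i)
                      ≡ respects (lookup D i) (lookup C i) (lookup S i)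
    pointwise i with i Fin.≟ e
    ... | yes refl rewrite lookup-update D e d | lookup-update C e c | lookup-update S e s = he
    ... | no ne rewrite lookup-update′ D e i d ne | lookup-update′ C e i c ne | lookup-update′ S e i s ne = refl

keep : ∀ {k} (X : Subset k) e → X [ e ]≔ lookup X e ≡ X
keep X e = VecP.[]≔-lookup X e

within-delete : ∀ {k} (D C S : Subset k) e → lookup S e ≡ false → within (insert D e) C S ≡ within D C S
within-delete D C S e se =
  trans (sym (cong₂ (within (insert D e)) (keep C e) (keep S e))) (within-set D C S e true _ _ (by se))
  where
    by : lookup S e ≡ false → respects true (lookup C e) (lookup S e) ≡ respects (lookup D e) (lookup C e) (lookup S e)
    by se rewrite se = refl

within-delete-∈ : ∀ {k} (D C S : Subset k) e → lookup S e ≡ true → within (insert D e) C S ≡ false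
within-delete-∈ D C S e se = within-false (insert D e) C S e (by (lookup C e) (lookup-update D e true) se)
  where
    by : ∀ {d s} c → d ≡ true → s ≡ true → respects d c s ≡ false
    by true refl refl = refl
    by false refl refl = refl

within-contract : ∀ {k} (D C S : Subset k) e → lookup S e ≡ true → within D (insert C e) S ≡ within D C S
within-contract D C S e se =
  trans (sym (cong₂ (λ X Y → within X (insert C e) Y) (keep D e) (keep S e))) (within-set D C S e _ true _ (by se))
  where
    by : lookup S e ≡ true → respects (lookup D e) true (lookup S e) ≡ respects (lookup D e) (lookup C e) (lookup S e)
    by se rewrite se with lookup C e
    ... | true = refl
    ... | false = refl

within-contract-∉ : ∀ {k} (D C S : Subset k) e → lookup S e ≡ false → within D (insert C e) S ≡ false
within-contract-∉ D C S e se = within-false D (insert C e) S e (by (lookup D e) (lookup-update C e true) se)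
  where
    by : ∀ {c s} d → c ≡ true → s ≡ false → respects d c s ≡ false
    by d refl refl = refl

within-insert : ∀ {k} (D C S : Subset k) e → lookup D e ≡ false → lookup C e ≡ false → lookup S e ≡ false →
  within D C (insert S e) ≡ within D C S
within-insert D C S e de ce se =
  trans (sym (cong₂ (λ X Y → within X Y (insert S e)) (keep D e) (keep C e))) (within-set D C S e _ _ true by)
  where
    by : respects (lookup D e) (lookup C e) true ≡ respects (lookup D e) (lookup C e) (lookup S e)
    by rewrite de | ce | se = refl

within-contract-insert : ∀ {k} (D C S : Subset k) e → lookup D e ≡ false → lookup C e ≡ false → lookup S e ≡ false →
  within D (insert C e) (insert S e) ≡ within D C S
within-contract-insert D C S e de ce se =
  trans (sym (cong (λ X → within X (insert C e) (insert S e)) (keep D e))) (within-set D C S e _ true true by)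
  where
    by : respects (lookup D e) true true ≡ respects (lookup D e) (lookup C e) (lookup S e)
    by rewrite de | ce | se = refl

module Minors {n m : ℕ} (ends : Fin m → Fin n × Fin n) where
  open Connectivity ends public

  Disjoint : Sub → Sub → Set
  Disjoint D C = ∀ i → lookup D i ≡ true → lookup C i ≡ false

  remaining : Sub → Fin m → Sub
  remaining D e = ∁ D [ e ]≔ false

  ∁-insert : ∀ D e → ∁ (insert D e) ≡ remaining D e
  ∁-insert D e = subset-ext _ _ pointwise
    where
      pointwise : ∀ i → lookup (∁ (insert D e)) i ≡ lookup (remaining D e) i
      pointwise i with i Fin.≟ e
      ... | yes refl = trans (lookup-∁ (insert D e) e)
                         (trans (cong not (lookup-update D e true)) (sym (lookup-update (∁ D) e false)))
      ... | no ne = trans (lookup-∁ (insert D e) i) (trans (cong not (lookup-update′ D e i true ne))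
                      (trans (sym (lookup-∁ D i)) (sym (lookup-update′ (∁ D) e i false ne))))

  insert-remaining : ∀ D e → lookup D e ≡ false → insert (remaining D e) e ≡ ∁ D
  insert-remaining D e h = insert-remove (∁ D) e (trans (lookup-∁ D e) (cong not h))

  remaining⊆∁ : ∀ D e → remaining D e ⊆ ∁ D
  remaining⊆∁ D e i q with i Fin.≟ e
  ... | yes refl = true≢false q (lookup-update (∁ D) e false)
  ... | no ne = trans (sym (lookup-update′ (∁ D) e i false ne)) q

  C⊆remaining : ∀ D C e → Disjoint D C → lookup C e ≡ false → C ⊆ remaining D e
  C⊆remaining D C e dj ce i q with i Fin.≟ e
  ... | yes refl = true≢false q ce
  ... | no ne with lookup D i in eq
  ...   | true = true≢false q (dj i eq)
  ...   | false = trans (lookup-update′ (∁ D) e i false ne) (trans (lookup-∁ D i) (cong not eq))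

  within⇒S⊆remaining : ∀ D C S e → within D C S ≡ true → lookup S e ≡ false → S ⊆ remaining D e
  within⇒S⊆remaining D C S e h se i q with i Fin.≟ e
  ... | yes refl = true≢false q se
  ... | no ne = trans (lookup-update′ (∁ D) e i false ne) (within⇒S⊆∁D D C S h i q)

  -- A loop of the minor joins two vertices already joined by C ⊆ G \ D \ e,
  -- so deleting it keeps the number of components of G \ D.
  c-delete-loop : ∀ D C e → Disjoint D C → lookup D e ≡ false → lookup C e ≡ false →
    isLoopIn ends D C e ≡ true → c ends (remaining D e) ≡ c ends (∁ D)
  c-delete-loop D C e dj de ce h =
    trans (sym (c-insert-connected (remaining D e) e (conn-mono (C⊆remaining D C e dj ce) h)))
          (cong (c ends) (insert-remaining D e de))

  c-delete-isthmus : ∀ D C e → lookup D e ≡ false → isIsthmusIn ends D C e ≡ true →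
    (c ends (remaining D e) ≡ suc (c ends (∁ D))) × (conn (remaining D e) (src e) (tgt e) ≡ false)
  c-delete-isthmus D C e de h = ℕP.≤-antisym at-most-one more , separated
    where
      more : c ends (∁ D) < c ends (remaining D e)
      more = ℕP.<ᵇ⇒< _ _ (≡true⇒T h)
      at-most-one : c ends (remaining D e) ≤ suc (c ends (∁ D))
      at-most-one = subst (λ z → c ends (remaining D e) ≤ suc (c ends z)) (insert-remaining D e de) (c-insert (remaining D e) e)
      separated : conn (remaining D e) (src e) (tgt e) ≡ false
      separated with conn (remaining D e) (src e) (tgt e) in q
      ... | false = refl
      ... | true = ⊥-elim (ℕP.<-irrefl (trans (sym (cong (c ends) (insert-remaining D e de)))
                                              (c-insert-connected (remaining D e) e q)) more)

  c-delete-standard : ∀ D C e → isIsthmusIn ends D C e ≡ false → c ends (remaining D e) ≡ c ends (∁ D)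
  c-delete-standard D C e h = ℕP.≤-antisym (ℕP.≮⇒≥ not-more) (c-mono (remaining D e) (∁ D) (remaining⊆∁ D e))
    where
      not-more : ¬ (c ends (∁ D) < c ends (remaining D e))
      not-more q = true≢false (T⇒≡true (ℕP.<⇒<ᵇ q)) h

within-∁ : ∀ {k} (D S : Subset k) → within D (∁ D) S ≡ (S == ∁ D)
within-∁ D S = bool-ext forward backward
  where
    forward : within D (∁ D) S ≡ true → (S == ∁ D) ≡ true
    forward h = subst (λ X → (X == ∁ D) ≡ true) (sym (subset-ext S (∁ D) pointwise)) (==-refl (∁ D))
      where
        decided : ∀ {d s} → respects d (not d) s ≡ true → s ≡ not d
        decided {true} {false} _ = refl
        decided {false} {true} _ = refl
        pointwise : ∀ i → lookup S i ≡ lookup (∁ D) i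
        pointwise i = trans (decided (subst (λ z → respects (lookup D i) z (lookup S i) ≡ true)
                                       (lookup-∁ D i) (within⇒respects D (∁ D) S h i)))
                            (sym (lookup-∁ D i))
    backward : (S == ∁ D) ≡ true → within D (∁ D) S ≡ true
    backward h rewrite ==-sound S (∁ D) h = all-tabulate⇐ _ (λ i → i) λ i → subst (λ z → respects (lookup D i) z z ≡ true)
                                                                          (sym (lookup-∁ D i)) (self (lookup D i))
      where
        self : ∀ d → respects d (not d) (not d) ≡ true
        self true = refl
        self false = refl

module TutteMinor {n m : ℕ} (ends : Fin m → Fin n × Fin n) (x y : ℤ) where
  open Minors ends public

  X₁ Y₁ : ℤ
  X₁ = x - ℤ.+ 1
  Y₁ = y - ℤ.+ 1

  summand : ℕ → Sub → ℤ
  summand k S = (X₁ ^ (c ends S ∸ k)) * (Y₁ ^ β ends S)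

  restricted : ℕ → Sub → Sub → Sub → ℤ
  restricted k D C S = if within D C S then summand k S else 0ℤ

  tutteMinor : Sub → Sub → ℤ
  tutteMinor D C = ΣS (restricted (c ends (∁ D)) D C)

  β-insert : ∀ S e → lookup S e ≡ false → c ends (insert S e) ≡ c ends S → β ends (insert S e) ≡ suc (β ends S)
  β-insert S e se ce = begin
    (c ends (insert S e) ℕ.+ ∣ insert S e ∣) ∸ n ≡⟨ cong₂ (λ a b → (a ℕ.+ b) ∸ n) ce (∣insert∣ S e se) ⟩
    (c ends S ℕ.+ suc ∣ S ∣) ∸ n               ≡⟨ cong (_∸ n) (ℕP.+-suc (c ends S) _) ⟩
    suc (c ends S ℕ.+ ∣ S ∣) ∸ n               ≡⟨ ℕP.+-∸-assoc 1 (rank S) ⟩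
    suc (β ends S)                             ∎
    where open ≡-Reasoning

  summand-loop : ∀ k D C S e → within D C S ≡ true → lookup S e ≡ false → isLoopIn ends D C e ≡ true →
    summand k (insert S e) ≡ Y₁ * summand k S
  summand-loop k D C S e h se loop =
    trans (cong₂ (λ a b → (X₁ ^ (a ∸ k)) * (Y₁ ^ b)) same (β-insert S e se same))
          (x∙yz≈y∙xz (X₁ ^ (c ends S ∸ k)) Y₁ (Y₁ ^ β ends S))
    where
      same : c ends (insert S e) ≡ c ends S
      same = c-insert-connected S e (conn-mono (within⇒C⊆S D C S h) loop)

  summand-isthmus : ∀ D C S e → within D C S ≡ true → lookup D e ≡ false → lookup S e ≡ false →
    isIsthmusIn ends D C e ≡ true → summand (c ends (∁ D)) S ≡ X₁ * summand (c ends (∁ D)) (insert S e)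
  summand-isthmus D C S e h de se isth =
    trans (cong₂ (λ a b → (X₁ ^ a) * (Y₁ ^ b)) exponent nullity) (ℤP.*-assoc X₁ _ _)
    where
      k = c ends (∁ D)
      separated : conn S (src e) (tgt e) ≡ false
      separated with conn S (src e) (tgt e) in q
      ... | false = refl
      ... | true = true≢false (conn-mono (within⇒S⊆remaining D C S e h se) q) (proj₂ (c-delete-isthmus D C e de isth))
      bridge : c ends S ≡ suc (c ends (insert S e))
      bridge = c-insert-bridge S e separated
      S+e⊆∁D : insert S e ⊆ ∁ D
      S+e⊆∁D i q with i Fin.≟ e
      ... | yes refl = trans (lookup-∁ D e) (cong not de)
      ... | no ne = within⇒S⊆∁D D C S h i (trans (sym (lookup-update′ S e i true ne)) q)
      exponent : c ends S ∸ k ≡ suc (c ends (insert S e) ∸ k)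
      exponent = trans (cong (_∸ k) bridge) (ℕP.+-∸-assoc 1 (c-mono (insert S e) (∁ D) S+e⊆∁D))
      nullity : β ends S ≡ β ends (insert S e)
      nullity = cong (_∸ n) (trans (cong (ℕ._+ ∣ S ∣) bridge)
                  (trans (sym (ℕP.+-suc _ _)) (cong (c ends (insert S e) ℕ.+_) (sym (∣insert∣ S e se)))))

  -- Deletion of a loop e: T = y · T(G \ e).  The subsets containing e are the
  -- subsets without e plus e, each contributing one more factor y - 1.
  tutte-loop : ∀ D C e → Disjoint D C → lookup D e ≡ false → lookup C e ≡ false → isLoopIn ends D C e ≡ true →
    tutteMinor D C ≡ y * tutteMinor (insert D e) C
  tutte-loop D C e dj de ce loop = begin
    ΣS (restricted k D C)
      ≡⟨ ΣS-split e (restricted k D C) ⟩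
    ΣS (λ S → if lookup S e then restricted k D C S else 0ℤ) + ΣS (λ S → if lookup S e then 0ℤ else restricted k D C S)
      ≡⟨ cong₂ _+_ (trans (ΣS-shift e (restricted k D C)) (trans (ΣS-cong _ _ with-e) (ΣS-* Y₁ deleted)))
                   (ΣS-cong _ _ without-e) ⟩
    Y₁ * ΣS deleted + ΣS deleted
      ≡⟨ pred-*-+ y (ΣS deleted) ⟩
    y * ΣS deleted
      ≡⟨ cong (λ z → y * ΣS (restricted z (insert D e) C)) (sym same-c) ⟩
    y * tutteMinor (insert D e) C ∎
    where
      open ≡-Reasoning
      k = c ends (∁ D)
      same-c : c ends (∁ (insert D e)) ≡ k
      same-c = trans (cong (c ends) (∁-insert D e)) (c-delete-loop D C e dj de ce loop)
      deleted : Sub → ℤ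
      deleted = restricted k (insert D e) C
      with-e : ∀ S → (if lookup S e then 0ℤ else restricted k D C (insert S e)) ≡ Y₁ * deleted S
      with-e S with lookup S e in se
      ... | true rewrite within-delete-∈ D C S e se = sym (ℤP.*-zeroʳ Y₁)
      ... | false rewrite within-insert D C S e de ce se | within-delete D C S e se with within D C S in h
      ...   | true = summand-loop k D C S e h se loop
      ...   | false = sym (ℤP.*-zeroʳ Y₁)
      without-e : ∀ S → (if lookup S e then 0ℤ else restricted k D C S) ≡ deleted S
      without-e S with lookup S e in se
      ... | true rewrite within-delete-∈ D C S e se = refl
      ... | false rewrite within-delete D C S e se = refl

  -- Contraction of an isthmus e: T = x · T(G / e).  Dropping e from a subset
  -- containing it costs one factor x - 1.
  tutte-isthmus : ∀ D C e → lookup D e ≡ false → lookup C e ≡ false → isIsthmusIn ends D C e ≡ true →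
    tutteMinor D C ≡ x * tutteMinor D (insert C e)
  tutte-isthmus D C e de ce isth = begin
    ΣS (restricted k D C)
      ≡⟨ ΣS-split e (restricted k D C) ⟩
    ΣS (λ S → if lookup S e then restricted k D C S else 0ℤ) + ΣS (λ S → if lookup S e then 0ℤ else restricted k D C S)
      ≡⟨ cong₂ _+_ (ΣS-cong _ _ with-e)
                   (trans (ΣS-cong _ _ without-e) (trans (sym (ΣS-shift e (λ S → X₁ * contracted S)))
                     (trans (ΣS-cong _ _ only-with-e) (ΣS-* X₁ contracted)))) ⟩
    ΣS contracted + X₁ * ΣS contracted
      ≡⟨ +-pred-* x (ΣS contracted) ⟩
    x * tutteMinor D (insert C e) ∎
    where
      open ≡-Reasoning
      k = c ends (∁ D)
      contracted : Sub → ℤ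
      contracted = restricted k D (insert C e)
      with-e : ∀ S → (if lookup S e then restricted k D C S else 0ℤ) ≡ contracted S
      with-e S with lookup S e in se
      ... | true rewrite within-contract D C S e se = refl
      ... | false rewrite within-contract-∉ D C S e se = refl
      without-e : ∀ S → (if lookup S e then 0ℤ else restricted k D C S) ≡
                        (if lookup S e then 0ℤ else X₁ * contracted (insert S e))
      without-e S with lookup S e in se
      ... | true = refl
      ... | false rewrite within-contract-insert D C S e de ce se with within D C S in h
      ...   | true = summand-isthmus D C S e h de se isth
      ...   | false = sym (ℤP.*-zeroʳ X₁)
      only-with-e : ∀ S → (if lookup S e then X₁ * contracted S else 0ℤ) ≡ X₁ * contracted S
      only-with-e S with lookup S e in se
      ... | true = refl
      ... | false rewrite within-contract-∉ D C S e se = sym (ℤP.*-zeroʳ X₁)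

  -- For a standard edge the subsets split into those avoiding e (deletion)
  -- and those containing it (contraction); c of G \ D is unchanged.
  tutte-standard : ∀ D C e → isIsthmusIn ends D C e ≡ false →
    tutteMinor D C ≡ tutteMinor (insert D e) C + tutteMinor D (insert C e)
  tutte-standard D C e not-isth = begin
    ΣS (restricted k D C)                                                     ≡⟨ ΣS-cong _ _ split ⟩
    ΣS (λ S → restricted k (insert D e) C S + restricted k D (insert C e) S)  ≡⟨ ΣS-+ _ _ ⟩
    ΣS (restricted k (insert D e) C) + tutteMinor D (insert C e)
      ≡⟨ cong (λ z → ΣS (restricted z (insert D e) C) + tutteMinor D (insert C e)) (sym same-c) ⟩
    tutteMinor (insert D e) C + tutteMinor D (insert C e)                     ∎
    where
      open ≡-Reasoning
      k = c ends (∁ D)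
      same-c : c ends (∁ (insert D e)) ≡ k
      same-c = trans (cong (c ends) (∁-insert D e)) (c-delete-standard D C e not-isth)
      split : ∀ S → restricted k D C S ≡ restricted k (insert D e) C S + restricted k D (insert C e) S
      split S with lookup S e in se
      ... | true rewrite within-delete-∈ D C S e se | within-contract D C S e se = sym (ℤP.+-identityˡ _)
      ... | false rewrite within-delete D C S e se | within-contract-∉ D C S e se = sym (ℤP.+-identityʳ _)

  tutte-done : ∀ D → c ends (∁ D) ℕ.+ ∣ ∁ D ∣ ≡ n → tutteMinor D (∁ D) ≡ ℤ.+ 1
  tutte-done D forest = begin
    ΣS (restricted k D (∁ D))                                    ≡⟨ ΣS-cong _ _ (λ S → cong (λ b → if b then summand k S else 0ℤ) (within-∁ D S)) ⟩
    ΣS (λ S → if S == ∁ D then summand k S else 0ℤ)              ≡⟨ ΣS-single (∁ D) (summand k) ⟩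
    (X₁ ^ (k ∸ k)) * (Y₁ ^ ((k ℕ.+ ∣ ∁ D ∣) ∸ n))                  ≡⟨ cong₂ (λ a b → (X₁ ^ a) * (Y₁ ^ b)) (ℕP.n∸n≡0 k)
                                                                       (trans (cong (_∸ n) forest) (ℕP.n∸n≡0 n)) ⟩
    ℤ.+ 1                                                        ∎
    where
      open ≡-Reasoning
      k = c ends (∁ D)

module ActivityMinor {n m : ℕ} (ends : Fin m → Fin n × Fin n) (x y : ℤ) where
  open Minors ends

  weight : List (Fin m) → Sub → ℤ
  weight L T = (x ^ length (filterᵇ (lookup T) L)) * (y ^ length (filterᵇ (λ e → not (lookup T e)) L))

  weight-∈ : ∀ T e L → lookup T e ≡ true → weight (e ∷ L) T ≡ x * weight L T
  weight-∈ T e L h rewrite h = ℤP.*-assoc x _ _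

  weight-∉ : ∀ T e L → lookup T e ≡ false → weight (e ∷ L) T ≡ y * weight L T
  weight-∉ T e L h rewrite h = x∙yz≈y∙xz (x ^ length (filterᵇ (lookup T) L)) y _

  spanning : Sub → Bool
  spanning = isSpanningTree ends

  activityMinor : (Sub → List (Fin m)) → Sub → Sub → ℤ
  activityMinor f D C = ΣS (λ T → if spanning T ∧ within D C T then weight (f T) T else 0ℤ)

  spanning⇒connected : ∀ T → spanning T ≡ true → c ends T ≡ 1
  spanning⇒connected T h = ℕP.≡ᵇ⇒≡ _ _ (≡true⇒T (proj₁ (∧-split h)))

  spanning⇒size : ∀ T → spanning T ≡ true → suc ∣ T ∣ ≤ n
  spanning⇒size T h = subst (λ z → z ℕ.+ ∣ T ∣ ≤ n) (spanning⇒connected T h)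
    (ℕP.m∸n≡0⇒m≤n (ℕP.≡ᵇ⇒≡ _ _ (≡true⇒T (proj₂ (∧-split {c ends T ℕ.≡ᵇ 1} h)))))

  -- A spanning tree through C never contains a loop of the minor (it would close a cycle).
  tree-avoids-loop : ∀ D C T e → spanning T ≡ true → within D C T ≡ true → lookup C e ≡ false →
    isLoopIn ends D C e ≡ true → lookup T e ≡ false
  tree-avoids-loop D C T e sp h ce loop with lookup T e in te
  ... | false = refl
  ... | true = ⊥-elim (ℕP.<-irrefl refl (ℕP.≤-trans (spanning⇒size T sp) (ℕP.≤-trans (rank T′) too-small)))
    where
      T′ = T [ e ]≔ false
      C⊆T′ : C ⊆ T′
      C⊆T′ i q with i Fin.≟ e
      ... | yes refl = true≢false q ce
      ... | no ne = trans (lookup-update′ T e i false ne) (within⇒C⊆S D C T h i q)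
      c-T′ : c ends T′ ≡ 1
      c-T′ = trans (sym (c-insert-connected T′ e (conn-mono C⊆T′ loop)))
                   (trans (cong (c ends) (insert-remove T e te)) (spanning⇒connected T sp))
      too-small : c ends T′ ℕ.+ ∣ T′ ∣ ≤ ∣ T ∣
      too-small = ℕP.≤-reflexive (trans (cong (ℕ._+ ∣ T′ ∣) c-T′)
                    (trans (sym (∣insert∣ T′ e (lookup-update T e false))) (cong ∣_∣ (insert-remove T e te))))

  tree-contains-isthmus : ∀ D C T e → spanning T ≡ true → within D C T ≡ true → lookup D e ≡ false →
    isIsthmusIn ends D C e ≡ true → lookup T e ≡ true
  tree-contains-isthmus D C T e sp h de isth with lookup T e in te
  ... | true = refl
  ... | false = ⊥-elim (ℕP.<-irrefl refl (ℕP.≤-trans (s≤s (c-pos (∁ D) (src e))) two≤one))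
    where
      two≤one : suc (c ends (∁ D)) ≤ 1
      two≤one = subst₂ _≤_ (proj₁ (c-delete-isthmus D C e de isth)) (spanning⇒connected T sp)
                  (c-mono T (remaining D e) (within⇒S⊆remaining D C T e h te))

  -- A loop label is externally active in every tree: factor y, then delete.
  activity-loop : ∀ f D C e → lookup C e ≡ false → isLoopIn ends D C e ≡ true →
    activityMinor (λ T → e ∷ f T) D C ≡ y * activityMinor f (insert D e) C
  activity-loop f D C e ce loop = trans (ΣS-cong _ _ pointwise) (ΣS-* y _)
    where
      Goal : Sub → Set
      Goal T = (if within D C T then weight (e ∷ f T) T else 0ℤ)
               ≡ y * (if within (insert D e) C T then weight (f T) T else 0ℤ)
      pointwise : ∀ T → (if spanning T ∧ within D C T then weight (e ∷ f T) T else 0ℤ)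
                        ≡ y * (if spanning T ∧ within (insert D e) C T then weight (f T) T else 0ℤ)
      pointwise T with spanning T in sp
      ... | false = sym (ℤP.*-zeroʳ y)
      ... | true = bool-cases (lookup T e) in-tree off-tree
        where
          in-tree : lookup T e ≡ true → Goal T
          in-tree te rewrite within-delete-∈ D C T e te with within D C T in h
          ... | true = true≢false te (tree-avoids-loop D C T e sp h ce loop)
          ... | false = sym (ℤP.*-zeroʳ y)
          off-tree : lookup T e ≡ false → Goal T
          off-tree te rewrite within-delete D C T e te with within D C T
          ... | true = weight-∉ T e (f T) te
          ... | false = sym (ℤP.*-zeroʳ y)

  -- An isthmus label is internally active in every tree: factor x, then contract.
  activity-isthmus : ∀ f D C e → lookup D e ≡ false → isIsthmusIn ends D C e ≡ true →
    activityMinor (λ T → e ∷ f T) D C ≡ x * activityMinor f D (insert C e)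
  activity-isthmus f D C e de isth = trans (ΣS-cong _ _ pointwise) (ΣS-* x _)
    where
      Goal : Sub → Set
      Goal T = (if within D C T then weight (e ∷ f T) T else 0ℤ)
               ≡ x * (if within D (insert C e) T then weight (f T) T else 0ℤ)
      pointwise : ∀ T → (if spanning T ∧ within D C T then weight (e ∷ f T) T else 0ℤ)
                        ≡ x * (if spanning T ∧ within D (insert C e) T then weight (f T) T else 0ℤ)
      pointwise T with spanning T in sp
      ... | false = sym (ℤP.*-zeroʳ x)
      ... | true = bool-cases (lookup T e) in-tree off-tree
        where
          in-tree : lookup T e ≡ true → Goal T
          in-tree te rewrite within-contract D C T e te with within D C T
          ... | true = weight-∈ T e (f T) te
          ... | false = sym (ℤP.*-zeroʳ x)
          off-tree : lookup T e ≡ false → Goal T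
          off-tree te rewrite within-contract-∉ D C T e te with within D C T in h
          ... | true = true≢false (tree-contains-isthmus D C T e sp h de isth) te
          ... | false = sym (ℤP.*-zeroʳ x)

  activity-standard : ∀ f₁ f₂ D C e →
    activityMinor (λ T → if lookup T e then f₂ T else f₁ T) D C ≡ activityMinor f₁ (insert D e) C + activityMinor f₂ D (insert C e)
  activity-standard f₁ f₂ D C e = trans (ΣS-cong _ _ pointwise) (ΣS-+ _ _)
    where
      pointwise : ∀ T → (if spanning T ∧ within D C T then weight (if lookup T e then f₂ T else f₁ T) T else 0ℤ) ≡
                        (if spanning T ∧ within (insert D e) C T then weight (f₁ T) T else 0ℤ)
                        + (if spanning T ∧ within D (insert C e) T then weight (f₂ T) T else 0ℤ)
      pointwise T with spanning T
      ... | false = refl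
      ... | true with lookup T e in te
      ...   | true rewrite within-delete-∈ D C T e te | within-contract D C T e te = sym (ℤP.+-identityˡ _)
      ...   | false rewrite within-delete D C T e te | within-contract-∉ D C T e te = sym (ℤP.+-identityʳ _)

  activity-done : ∀ D → c ends (∁ D) ≡ 1 → c ends (∁ D) ℕ.+ ∣ ∁ D ∣ ≡ n →
    activityMinor (λ _ → []) D (∁ D) ≡ ℤ.+ 1
  activity-done D connected forest = begin
    activityMinor (λ _ → []) D (∁ D)                              ≡⟨ ΣS-cong _ _ pointwise ⟩
    ΣS (λ T → if T == ∁ D then (if spanning T then ℤ.+ 1 else 0ℤ) else 0ℤ) ≡⟨ ΣS-single (∁ D) _ ⟩
    (if spanning (∁ D) then ℤ.+ 1 else 0ℤ)                       ≡⟨ cong (λ b → if b then ℤ.+ 1 else 0ℤ) is-tree ⟩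
    ℤ.+ 1                                                         ∎
    where
      open ≡-Reasoning
      pointwise : ∀ T → (if spanning T ∧ within D (∁ D) T then weight [] T else 0ℤ)
                        ≡ (if T == ∁ D then (if spanning T then ℤ.+ 1 else 0ℤ) else 0ℤ)
      pointwise T rewrite within-∁ D T with spanning T | T == ∁ D
      ... | true | true = refl
      ... | true | false = refl
      ... | false | true = refl
      ... | false | false = refl
      is-tree : spanning (∁ D) ≡ true
      is-tree rewrite connected | cong (_∸ n) forest | ℕP.n∸n≡0 n = refl

module Expansion {n m : ℕ} (ends : Fin m → Fin n × Fin n) (x y : ℤ) where
  open TutteMinor ends x y public
  open ActivityMinor ends x y public

  Undecided : Sub → Sub → Fin m → Set
  Undecided D C i = lookup D i ≡ false × lookup C i ≡ false

  -- The labels of Δ below the current node are exactly the undecided edges,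
  -- each met once along every path (the tree shape of this fact).
  Good : ∀ {d} → DTree m d → Sub → Sub → Set
  Good (leaf e) D C = Undecided D C e × (∀ i → Undecided D C i → i ≡ e)
  Good (node e l r) D C = Undecided D C e × Good l (insert D e) C × Good r D (insert C e)

  -- The global invariant of the expansion: C is a spanning forest of the
  -- connected graph G \ D.
  record Invariant (D C : Sub) : Set where
    field
      disjoint : Disjoint D C
      isForest : c ends C ℕ.+ ∣ C ∣ ≡ n
      isConnected : c ends (∁ D) ≡ 1
  open Invariant

  delete-invariant : ∀ D C e → Invariant D C → Undecided D C e → c ends (remaining D e) ≡ c ends (∁ D) →
    Invariant (insert D e) C
  delete-invariant D C e inv (_ , ce) same-c = record
    { disjoint = still-disjoint
    ; isForest = isForest inv
    ; isConnected = trans (cong (c ends) (∁-insert D e)) (trans same-c (isConnected inv)) }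
    where
      still-disjoint : Disjoint (insert D e) C
      still-disjoint i q with i Fin.≟ e
      ... | yes refl = ce
      ... | no ne = disjoint inv i (trans (sym (lookup-update′ D e i true ne)) q)

  contract-invariant : ∀ D C e → Invariant D C → Undecided D C e → isLoopIn ends D C e ≡ false →
    Invariant D (insert C e)
  contract-invariant D C e inv (de , ce) not-loop = record
    { disjoint = still-disjoint
    ; isForest = trans (cong (c ends (insert C e) ℕ.+_) (∣insert∣ C e ce))
                 (trans (ℕP.+-suc _ _) (trans (cong (ℕ._+ ∣ C ∣) (sym (c-insert-bridge C e not-loop))) (isForest inv)))
    ; isConnected = isConnected inv }
    where
      still-disjoint : Disjoint D (insert C e)
      still-disjoint i q with i Fin.≟ e
      ... | yes refl = true≢false q de
      ... | no ne = trans (lookup-update′ C e i true ne) (disjoint inv i q)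

  step-loop : ∀ f D C e → Invariant D C → Undecided D C e → isLoopIn ends D C e ≡ true →
    (Invariant (insert D e) C → activityMinor f (insert D e) C ≡ tutteMinor (insert D e) C) →
    activityMinor (λ T → e ∷ f T) D C ≡ tutteMinor D C
  step-loop f D C e inv (de , ce) loop ih = begin
    activityMinor (λ T → e ∷ f T) D C  ≡⟨ activity-loop f D C e ce loop ⟩
    y * activityMinor f (insert D e) C  ≡⟨ cong (y *_) (ih (delete-invariant D C e inv (de , ce) (c-delete-loop D C e (disjoint inv) de ce loop))) ⟩
    y * tutteMinor (insert D e) C       ≡⟨ sym (tutte-loop D C e (disjoint inv) de ce loop) ⟩
    tutteMinor D C                      ∎
    where open ≡-Reasoning

  step-isthmus : ∀ f D C e → Invariant D C → Undecided D C e →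
    isLoopIn ends D C e ≡ false → isIsthmusIn ends D C e ≡ true →
    (Invariant D (insert C e) → activityMinor f D (insert C e) ≡ tutteMinor D (insert C e)) →
    activityMinor (λ T → e ∷ f T) D C ≡ tutteMinor D C
  step-isthmus f D C e inv (de , ce) not-loop isth ih = begin
    activityMinor (λ T → e ∷ f T) D C  ≡⟨ activity-isthmus f D C e de isth ⟩
    x * activityMinor f D (insert C e)  ≡⟨ cong (x *_) (ih (contract-invariant D C e inv (de , ce) not-loop)) ⟩
    x * tutteMinor D (insert C e)       ≡⟨ sym (tutte-isthmus D C e de ce isth) ⟩
    tutteMinor D C                      ∎
    where open ≡-Reasoning

  step-standard : ∀ f₁ f₂ D C e → Invariant D C → Undecided D C e →
    isLoopIn ends D C e ≡ false → isIsthmusIn ends D C e ≡ false →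
    (Invariant (insert D e) C → activityMinor f₁ (insert D e) C ≡ tutteMinor (insert D e) C) →
    (Invariant D (insert C e) → activityMinor f₂ D (insert C e) ≡ tutteMinor D (insert C e)) →
    activityMinor (λ T → if lookup T e then f₂ T else f₁ T) D C ≡ tutteMinor D C
  step-standard f₁ f₂ D C e inv und not-loop not-isth ih₁ ih₂ = begin
    activityMinor (λ T → if lookup T e then f₂ T else f₁ T) D C
      ≡⟨ activity-standard f₁ f₂ D C e ⟩
    activityMinor f₁ (insert D e) C + activityMinor f₂ D (insert C e)
      ≡⟨ cong₂ _+_ (ih₁ (delete-invariant D C e inv und (c-delete-standard D C e not-isth)))
                   (ih₂ (contract-invariant D C e inv und not-loop)) ⟩
    tutteMinor (insert D e) C + tutteMinor D (insert C e)
      ≡⟨ sym (tutte-standard D C e not-isth) ⟩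
    tutteMinor D C ∎
    where open ≡-Reasoning

  expansion-done : ∀ D C → ∁ D ≡ C → Invariant D C → activityMinor (λ _ → []) D C ≡ tutteMinor D C
  expansion-done D .(∁ D) refl inv =
    trans (activity-done D (isConnected inv) (isForest inv)) (sym (tutte-done D (isForest inv)))

  last-edge : ∀ D C e → Invariant D C → Good (leaf e) D C → ∁ D ≡ insert C e
  last-edge D C e inv ((de , ce) , only) = subset-ext _ _ pointwise
    where
      pointwise : ∀ i → lookup (∁ D) i ≡ lookup (insert C e) i
      pointwise i with i Fin.≟ e
      ... | yes refl = trans (lookup-∁ D e) (trans (cong not de) (sym (lookup-update C e true)))
      ... | no ne = trans (lookup-∁ D i) (trans (decided (lookup D i) (lookup C i) (disjoint inv i) (ne ∘ only i))
                      (sym (lookup-update′ C e i true ne)))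
        where
          decided : ∀ d c → (d ≡ true → c ≡ false) → ¬ (d ≡ false × c ≡ false) → not d ≡ c
          decided true c dj _ = sym (dj refl)
          decided false true _ _ = refl
          decided false false _ und = ⊥-elim (und (refl , refl))

  last-edge-deleted : ∀ D C e → Invariant D C → Good (leaf e) D C → ∁ (insert D e) ≡ C
  last-edge-deleted D C e inv good@((_ , ce) , _) = begin
    ∁ (insert D e)              ≡⟨ ∁-insert D e ⟩
    ∁ D [ e ]≔ false            ≡⟨ cong (_[ e ]≔ false) (last-edge D C e inv good) ⟩
    insert C e [ e ]≔ false     ≡⟨ VecP.[]≔-idempotent C e ⟩
    C [ e ]≔ false              ≡⟨ cong (C [ e ]≔_) (sym ce) ⟩
    C [ e ]≔ lookup C e         ≡⟨ keep C e ⟩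
    C                           ∎
    where open ≡-Reasoning

  -- The last edge of a connected graph whose other edges form a spanning
  -- forest is a loop or an isthmus, never standard.
  last-edge-not-standard : ∀ D C e → Invariant D C → Good (leaf e) D C →
    isLoopIn ends D C e ≡ false → isIsthmusIn ends D C e ≡ true
  last-edge-not-standard D C e inv good not-loop =
    T⇒≡true (ℕP.<⇒<ᵇ (subst₂ _<_ (cong (c ends) (sym (last-edge D C e inv good))) split ℕP.≤-refl))
    where
      split : suc (c ends (insert C e)) ≡ c ends (remaining D e)
      split = trans (sym (c-insert-bridge C e not-loop))
                (cong (c ends) (trans (sym (last-edge-deleted D C e inv good)) (∁-insert D e)))

  expansion : ∀ {d} (Δ : DTree m d) D C → Good Δ D C → Invariant D C →
    activityMinor (λ T → activeRun ends Δ T D C) D C ≡ tutteMinor D C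
  expansion (node e l r) D C (und , good-l , good-r) inv with isLoopIn ends D C e in loop
  ... | true = step-loop _ D C e inv und loop (expansion l (insert D e) C good-l)
  ... | false with isIsthmusIn ends D C e in isth
  ...   | true = step-isthmus _ D C e inv und loop isth (expansion r D (insert C e) good-r)
  ...   | false = step-standard _ _ D C e inv und loop isth (expansion l (insert D e) C good-l)
                                                                (expansion r D (insert C e) good-r)
  expansion (leaf e) D C good@(und , _) inv with isLoopIn ends D C e in loop
  ... | true = step-loop _ D C e inv und loop (expansion-done (insert D e) C (last-edge-deleted D C e inv good))
  ... | false with isIsthmusIn ends D C e in isth
  ...   | true = step-isthmus _ D C e inv und loop isth (expansion-done D (insert C e) (last-edge D C e inv good))
  ...   | false = true≢false (last-edge-not-standard D C e inv good loop) isth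

  Enumerates : ∀ {d} → DTree m d → Sub → Sub → Set
  Enumerates {d} Δ D C = ∀ (p : Vec Bool d) →
    Unique (pathLabels Δ p) × (∀ i → i ∈ pathLabels Δ p → Undecided D C i) × (∀ i → Undecided D C i → i ∈ pathLabels Δ p)

  insert-false⇒ : ∀ (X : Sub) e i → lookup (insert X e) i ≡ false → lookup X i ≡ false × i ≢ e
  insert-false⇒ X e i h with i Fin.≟ e
  ... | yes refl = true≢false (lookup-update X e true) h
  ... | no ne = trans (sym (lookup-update′ X e i true ne)) h , ne

  insert-false⇐ : ∀ (X : Sub) e i → lookup X i ≡ false → i ≢ e → lookup (insert X e) i ≡ false
  insert-false⇐ X e i h ne = trans (lookup-update′ X e i true ne) h

  enumerates-child : ∀ {d} (L : Vec Bool d → List (Fin m)) e D C D′ C′ →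
    (∀ p → Unique (e ∷ L p) × (∀ i → i ∈ e ∷ L p → Undecided D C i) × (∀ i → Undecided D C i → i ∈ e ∷ L p)) →
    (∀ i → Undecided D′ C′ i → Undecided D C i × i ≢ e) → (∀ i → Undecided D C i → i ≢ e → Undecided D′ C′ i) →
    ∀ p → Unique (L p) × (∀ i → i ∈ L p → Undecided D′ C′ i) × (∀ i → Undecided D′ C′ i → i ∈ L p)
  enumerates-child L e D C D′ C′ h shrink keep-rest p with h p
  ... | (e∉L ∷ unique) , sound , complete = unique , sound′ , complete′
    where
      sound′ : ∀ i → i ∈ L p → Undecided D′ C′ i
      sound′ i q = keep-rest i (sound i (there q)) (λ eq → All.lookup e∉L (subst (_∈ L p) eq q) refl)
      complete′ : ∀ i → Undecided D′ C′ i → i ∈ L p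
      complete′ i u with complete i (proj₁ (shrink i u))
      ... | here eq = ⊥-elim (proj₂ (shrink i u) eq)
      ... | there q = q

  good-from : ∀ {d} (Δ : DTree m d) D C → Enumerates Δ D C → Good Δ D C
  good-from (leaf e) D C h with h []ᵥ
  ... | _ , sound , complete = sound e (here refl) , λ i u → only (complete i u)
    where
      only : ∀ {i} → i ∈ e ∷ [] → i ≡ e
      only (here eq) = eq
  good-from {suc d} (node e l r) D C h =
    proj₁ (proj₂ (h (false ∷ᵥ Data.Vec.replicate d false))) e (here refl) ,
    good-from l (insert D e) C (enumerates-child (pathLabels l) e D C (insert D e) C (λ p → h (false ∷ᵥ p)) shrink-D rest-D) ,
    good-from r D (insert C e) (enumerates-child (pathLabels r) e D C D (insert C e) (λ p → h (true ∷ᵥ p)) shrink-C rest-C)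
    where
      shrink-D : ∀ i → Undecided (insert D e) C i → Undecided D C i × i ≢ e
      shrink-D i (d , c) = (proj₁ (insert-false⇒ D e i d) , c) , proj₂ (insert-false⇒ D e i d)
      rest-D : ∀ i → Undecided D C i → i ≢ e → Undecided (insert D e) C i
      rest-D i (d , c) ne = insert-false⇐ D e i d ne , c
      shrink-C : ∀ i → Undecided D (insert C e) i → Undecided D C i × i ≢ e
      shrink-C i (d , c) = (d , proj₁ (insert-false⇒ C e i c)) , proj₂ (insert-false⇒ C e i c)
      rest-C : ∀ i → Undecided D C i → i ≢ e → Undecided D (insert C e) i
      rest-C i (d , c) ne = d , insert-false⇐ C e i c ne

  root-good : ∀ {d} (Δ : DTree m d) → (∀ p → pathLabels Δ p ↭ allFin m) → Good Δ ∅ ∅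
  root-good Δ perm = good-from Δ ∅ ∅ λ p →
    PermutationSetoid.Unique-resp-↭ (setoid (Fin m)) (↭⇒↭ₛ (↭-sym (perm p))) (allFin⁺ m) ,
    (λ i _ → lookup-∅ i , lookup-∅ i) ,
    (λ i _ → ∈-resp-↭ (↭-sym (perm p)) (∈-allFin i))

  root-invariant : c ends ⊤ ≡ 1 → Invariant ∅ ∅
  root-invariant connected-G = record
    { disjoint = λ i q → true≢false q (lookup-∅ i)
    ; isForest = trans (cong (c ends ∅ ℕ.+_) (∣⊥∣≡0 m)) (trans (ℕP.+-identityʳ _) c-∅)
    ; isConnected = trans (cong (c ends) ∁-∅) connected-G }

  tutte-root : tutte ends x y ≡ tutteMinor ∅ ∅
  tutte-root = trans (sym (ΣS-def _)) (ΣS-cong _ _ at-root)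
    where
      at-root : ∀ S → summand (c ends ⊤) S ≡ restricted (c ends (∁ ∅)) ∅ ∅ S
      at-root S rewrite within-∅ S | ∁-∅ {m} = refl

  activity-root : ∀ {d} (Δ : DTree m d) → activitySum ends Δ x y ≡ activityMinor (active ends Δ) ∅ ∅
  activity-root Δ = trans (sym (ΣS-def _)) (ΣS-cong _ _ at-root)
    where
      at-root : ∀ T → (if spanning T then weight (active ends Δ T) T else 0ℤ)
                      ≡ (if spanning T ∧ within ∅ ∅ T then weight (active ends Δ T) T else 0ℤ)
      at-root T rewrite within-∅ T | ∧-identityʳ (spanning T) = refl

theorem4p1 : ∀ {n k : ℕ} (ends : Fin (suc k) → Fin n × Fin n)
    → c ends ⊤ ≡ 1
    → (Δ : DTree (suc k) k) → IsDecisionTree Δ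
    → ∀ (x y : ℤ) → tutte ends x y ≡ activitySum ends Δ x y
theorem4p1 ends connected-G Δ decision-tree x y = begin
  tutte ends x y                      ≡⟨ tutte-root ⟩
  tutteMinor ∅ ∅                      ≡⟨ sym (expansion Δ ∅ ∅ (root-good Δ decision-tree) (root-invariant connected-G)) ⟩
  activityMinor (active ends Δ) ∅ ∅   ≡⟨ sym (activity-root Δ) ⟩
  activitySum ends Δ x y              ∎
  where
    open Expansion ends x y
    open ≡-Reasoning
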